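{- For an integer $n \geq 1$, let $\mathcal P(n) = \{x_i^2 - x_i : i \in [2n]\} \cup \{\sum_{i=1}^{2n} x_i - n\} \subseteq \mathbb R[x_1,\dots,x_{2n}]$, and let $S(n) \subseteq \{0,1\}^{2n}$ be its set of common real zeros (the Boolean strings with exactly $n$ ones). Then for every $d \leq n$, $\mathcal P(n)$ is $d$-complete on $S(n)$ up to degree $d$: for every vector $c$ with $M c = 0$, where $M = \mathbb E_{\alpha \in S(n)}[\mathbf v(\alpha)\mathbf v(\alpha)^T]$, the polynomial $c^T \mathbf v$ has a derivation of degree $d$ from $\mathcal P(n)$.
   Context: $\mathbf v$ is the vector of all monomials in $x_1,\dots,x_{2n}$ of degree at most $d$, and the expectation is over the uniform distribution on $S(n)$. A derivation of degree $d$ of a polynomial $f$ from $\mathcal P$ is an identity $f = \sum_i \lambda_i p_i$ with $p_i \in \mathcal P$, $\lambda_i$ real polynomials, and $\max_i \deg(\lambda_i p_i) \leq d$.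
   Formalization: The vector c has rational entries, and the polynomials of 𝒫(n) and the multipliers λ_i of a derivation are taken over ℚ rather than ℝ. -}

module Defs where

open import Data.Nat as ℕ using (ℕ; zero; suc; _∸_)
open import Data.Bool using (Bool; true; false)
open import Data.Fin using (Fin)
open import Data.Integer using (+_)
open import Data.Rational using (ℚ; 0ℚ; 1ℚ; _+_; _*_; -_; _-_; _/_)
open import Data.Product using (_×_; _,_; Σ-syntax)
open import Data.Sum using (_⊎_; inj₁; inj₂)
open import Data.Unit using (⊤)
open import Data.List as List using (List; []; _∷_; _++_; map; concatMap; upTo; filter; length; lookup; allFin)
open import Data.Vec as Vec using (Vec; []; _∷_)
open import Relation.Binary.PropositionalEquality using (_≡_; _≢_)
open import Relation.Nullary.Decidable using (does)
open import Data.List.Membership.Propositional using (_∈_)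

Mon : ℕ → Set
Mon k = Vec ℕ k

totalDeg : ∀ {k} → Mon k → ℕ
totalDeg []       = 0
totalDeg (e ∷ es) = e ℕ.+ totalDeg es

monEq : ∀ {k} → Mon k → Mon k → Bool
monEq []       []       = true
monEq (a ∷ as) (b ∷ bs) with does (a ℕ.≟ b)
... | true  = monEq as bs
... | false = false

-- A polynomial is a finite formal sum of terms (coefficient, monomial).
-- Two term lists denote the same polynomial iff all coefficients agree.
Poly : ℕ → Set
Poly k = List (ℚ × Mon k)

sumℚ : List ℚ → ℚ
sumℚ = List.foldr _+_ 0ℚ

coeff : ∀ {k} → Poly k → Mon k → ℚ
coeff []             m = 0ℚ
coeff ((c , m′) ∷ f) m with monEq m′ m
... | true  = c + coeff f m
... | false = coeff f m

_≈P_ : ∀ {k} → Poly k → Poly k → Set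
f ≈P g = ∀ m → coeff f m ≡ coeff g m

DegLe : ∀ {k} → Poly k → ℕ → Set
DegLe f d = ∀ m → coeff f m ≢ 0ℚ → totalDeg m ℕ.≤ d

zeroMon : ∀ k → Mon k
zeroMon k = Vec.replicate k 0

varMon : ∀ {k} → Fin k → Mon k
varMon {k} i = Vec.updateAt (zeroMon k) i (λ _ → 1)

sqMon : ∀ {k} → Fin k → Mon k
sqMon {k} i = Vec.updateAt (zeroMon k) i (λ _ → 2)

const : ∀ {k} → ℚ → Poly k
const {k} c = (c , zeroMon k) ∷ []

_+P_ : ∀ {k} → Poly k → Poly k → Poly k
_+P_ = _++_

_*P_ : ∀ {k} → Poly k → Poly k → Poly k
f *P g = concatMap (λ { (a , m) → map (λ { (b , m′) → (a * b , Vec.zipWith ℕ._+_ m m′) }) g }) f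

boolℚ : Bool → ℚ
boolℚ true  = 1ℚ
boolℚ false = 0ℚ

powℚ : ℚ → ℕ → ℚ
powℚ q zero    = 1ℚ
powℚ q (suc e) = q * powℚ q e

evalMon : ∀ {k} → Mon k → Vec Bool k → ℚ
evalMon []       []       = 1ℚ
evalMon (e ∷ es) (b ∷ bs) = powℚ (boolℚ b) e * evalMon es bs

Gen : ℕ → Set
Gen n = Fin (2 ℕ.* n) ⊎ ⊤

genPoly : ∀ n → Gen n → Poly (2 ℕ.* n)
genPoly n (inj₁ i) = (1ℚ , sqMon i) ∷ (- 1ℚ , varMon i) ∷ []
genPoly n (inj₂ _) =
  map (λ i → (1ℚ , varMon i)) (allFin (2 ℕ.* n)) +P const (- (+ n / 1))

combine : ∀ n → List (Poly (2 ℕ.* n) × Gen n) → Poly (2 ℕ.* n)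
combine n []              = []
combine n ((lam , g) ∷ ds) = (lam *P genPoly n g) +P combine n ds

Derivation : ∀ n → Poly (2 ℕ.* n) → ℕ → Set
Derivation n f d =
  Σ[ ds ∈ List (Poly (2 ℕ.* n) × Gen n) ]
    ((f ≈P combine n ds)
    × (∀ {lam g} → (lam , g) ∈ ds → DegLe (lam *P genPoly n g) d))

allBool : ∀ k → List (Vec Bool k)
allBool zero    = [] ∷ []
allBool (suc k) = concatMap (λ b → map (b ∷_) (allBool k)) (true ∷ false ∷ [])

countOnes : ∀ {k} → Vec Bool k → ℕ
countOnes []           = 0
countOnes (true ∷ bs)  = suc (countOnes bs)
countOnes (false ∷ bs) = countOnes bs

S : ∀ n → List (Vec Bool (2 ℕ.* n))
S n = filter (λ α → countOnes α ℕ.≟ n) (allBool (2 ℕ.* n))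

avg : List ℚ → ℚ
avg []       = 0ℚ
avg (x ∷ xs) = sumℚ (x ∷ xs) * ((+ 1) / suc (length xs))

Expect : ∀ n → (Vec Bool (2 ℕ.* n) → ℚ) → ℚ
Expect n F = avg (map F (S n))

monsUpTo : ∀ k → ℕ → List (Mon k)
monsUpTo zero    d = [] ∷ []
monsUpTo (suc k) d = concatMap (λ e → map (e ∷_) (monsUpTo k (d ∸ e))) (upTo (suc d))

Idx : ℕ → ℕ → Set
Idx n d = Fin (length (monsUpTo (2 ℕ.* n) d))

𝐯 : ∀ n d → Idx n d → Mon (2 ℕ.* n)
𝐯 n d = lookup (monsUpTo (2 ℕ.* n) d)

M : ∀ n d → Idx n d → Idx n d → ℚ
M n d i j = Expect n (λ α → evalMon (𝐯 n d i) α * evalMon (𝐯 n d j) α)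

Mc : ∀ n d → (Idx n d → ℚ) → Idx n d → ℚ
Mc n d c i = sumℚ (map (λ j → M n d i j * c j) (allFin _))

cTv : ∀ n d → (Idx n d → ℚ) → Poly (2 ℕ.* n)
cTv n d c = map (λ j → (c j , 𝐯 n d j)) (allFin _)

-- Write f = cᵀ𝐯. Since cᵀMc = 𝔼_{α ∈ S(n)} f(α)², the hypothesis Mc = 0 says that f vanishes on S(n).
-- Modulo degree-d derivations from 𝒫(n), x_i² − x_i makes every monomial of degree ≤ d squarefree,
-- and x_T (∑ x_i − n) gives (n − |T|) x_T ≡ ∑_{i ∉ T} x_{T ∪ {i}}; as |T| < d ≤ n this lifts x_T to
-- degree d. Hence f ≡ ∑_{|X| = d} a(X) x_X, and this polynomial still vanishes on S(n): for every
-- n-set α of [2n], ∑_{X ⊆ α} a(X) = 0. Because d ≤ n ≤ 2n − d, the inclusion matrix of d-sets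
-- against n-sets has full row rank (by induction on the ground set, raising a layer-c function to
-- layer c + 1 when the head coordinate is removed), so a = 0 and f itself has a degree-d derivation.

module Submission where

open import Level using (0ℓ)
open import Algebra.Bundles using (CommutativeMonoid)
import Algebra.Properties.CommutativeSemigroup as CommSemigroupProperties
open import Data.Bool using (Bool; true; false; if_then_else_; T)
open import Data.Empty using (⊥-elim)
open import Data.Fin as Fin using (Fin)
open import Data.Integer as ℤ using ()
import Data.Integer.Properties as ℤ
open import Data.List as List using (List; []; _∷_; _++_; map; concatMap; allFin; length)
import Data.List.Properties as List
open import Data.List.Membership.Propositional using (_∈_)
open import Data.List.Membership.Propositional.Properties
  using (∈-map⁺; ∈-map⁻; ∈-++⁻; ∈-++⁺ˡ; ∈-++⁺ʳ; ∈-filter⁺; ∈-lookup)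
open import Data.List.Relation.Unary.All as All using (All; []; _∷_)
import Data.List.Relation.Unary.All.Properties as All
open import Data.List.Relation.Unary.Any using (here; there)
open import Data.Nat as ℕ using (ℕ; zero; suc; _≤_; _<_; z≤n; s≤s)
import Data.Nat.Properties as ℕ
open import Data.Nat.Coprimality as Coprime using (1-coprimeTo)
open import Data.Nat.Induction using (<-wellFounded)
open import Data.Product using (_×_; _,_; proj₁; proj₂; Σ-syntax)
open import Data.Rational as ℚ using (ℚ; 0ℚ; 1ℚ; _+_; _*_; -_; _-_; _/_; 1/_) renaming (_≤_ to _≤ℚ_)
import Data.Rational.Properties as ℚ
open import Data.Sum using (_⊎_; inj₁; inj₂)
open import Data.Unit using (tt)
open import Data.Vec as Vec using (Vec; []; _∷_)
import Data.Vec.Properties as Vec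
open import Function using (_∘_; id)
open import Induction.WellFounded using (Acc; acc)
open import Relation.Binary.Bundles using (Setoid)
import Relation.Binary.Reasoning.Setoid
open import Relation.Binary.PropositionalEquality
open import Relation.Nullary using (yes; no)
open import Relation.Nullary.Decidable using (dec⇒maybe)
open import Relation.Nullary.Reflects using (Reflects; ofʸ; ofⁿ)
open import Tactic.RingSolver using (solve-∀)
open import Tactic.RingSolver.Core.AlmostCommutativeRing using (AlmostCommutativeRing; fromCommutativeRing)

open import Defs

ℚ-ring : AlmostCommutativeRing 0ℓ 0ℓ
ℚ-ring = fromCommutativeRing ℚ.+-*-commutativeRing (λ x → dec⇒maybe (0ℚ ℚ.≟ x))

module ℚ+ = CommSemigroupProperties (CommutativeMonoid.commutativeSemigroup ℚ.+-0-commutativeMonoid)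
module ℚ* = CommSemigroupProperties (CommutativeMonoid.commutativeSemigroup ℚ.*-1-commutativeMonoid)

module ℕ+ = CommSemigroupProperties ℕ.+-commutativeSemigroup

-- Finite sums of rationals

∑ : {A : Set} → List A → (A → ℚ) → ℚ
∑ xs f = sumℚ (map f xs)

syntax ∑ xs (λ x → e) = ∑[ x ∈ xs ] e

module _ {A : Set} where

  ∑-cong : (xs : List A) {f g : A → ℚ} → (∀ x → f x ≡ g x) → ∑ xs f ≡ ∑ xs g
  ∑-cong []       f≗g = refl
  ∑-cong (x ∷ xs) f≗g = cong₂ _+_ (f≗g x) (∑-cong xs f≗g)

  ∑-cong-∈ : (xs : List A) {f g : A → ℚ} → (∀ {x} → x ∈ xs → f x ≡ g x) → ∑ xs f ≡ ∑ xs g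
  ∑-cong-∈ []       f≗g = refl
  ∑-cong-∈ (x ∷ xs) f≗g = cong₂ _+_ (f≗g (here refl)) (∑-cong-∈ xs (f≗g ∘ there))

  ∑-zero : (xs : List A) {f : A → ℚ} → (∀ x → f x ≡ 0ℚ) → ∑ xs f ≡ 0ℚ
  ∑-zero []       f≗0 = refl
  ∑-zero (x ∷ xs) f≗0 = cong₂ _+_ (f≗0 x) (∑-zero xs f≗0)

  ∑-distrib-+ : (xs : List A) (f g : A → ℚ) → ∑[ x ∈ xs ] (f x + g x) ≡ ∑ xs f + ∑ xs g
  ∑-distrib-+ []       f g = refl
  ∑-distrib-+ (x ∷ xs) f g = begin
    (f x + g x) + ∑[ y ∈ xs ] (f y + g y) ≡⟨ cong ((f x + g x) +_) (∑-distrib-+ xs f g) ⟩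
    (f x + g x) + (∑ xs f + ∑ xs g)       ≡⟨ ℚ+.interchange (f x) (g x) (∑ xs f) (∑ xs g) ⟩
    (f x + ∑ xs f) + (g x + ∑ xs g)       ∎
    where open ≡-Reasoning

  *-distribˡ-∑ : (a : ℚ) (xs : List A) (f : A → ℚ) → a * ∑ xs f ≡ ∑[ x ∈ xs ] (a * f x)
  *-distribˡ-∑ a []       f = ℚ.*-zeroʳ a
  *-distribˡ-∑ a (x ∷ xs) f = trans (ℚ.*-distribˡ-+ a (f x) (∑ xs f)) (cong (a * f x +_) (*-distribˡ-∑ a xs f))

  *-distribʳ-∑ : (a : ℚ) (xs : List A) (f : A → ℚ) → ∑ xs f * a ≡ ∑[ x ∈ xs ] (f x * a)
  *-distribʳ-∑ a xs f = begin
    ∑ xs f * a            ≡⟨ ℚ.*-comm (∑ xs f) a ⟩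
    a * ∑ xs f            ≡⟨ *-distribˡ-∑ a xs f ⟩
    ∑[ x ∈ xs ] (a * f x) ≡⟨ ∑-cong xs (λ x → ℚ.*-comm a (f x)) ⟩
    ∑[ x ∈ xs ] (f x * a) ∎
    where open ≡-Reasoning

  ∑-++ : (xs ys : List A) (f : A → ℚ) → ∑ (xs ++ ys) f ≡ ∑ xs f + ∑ ys f
  ∑-++ []       ys f = sym (ℚ.+-identityˡ (∑ ys f))
  ∑-++ (x ∷ xs) ys f = trans (cong (f x +_) (∑-++ xs ys f)) (sym (ℚ.+-assoc (f x) (∑ xs f) (∑ ys f)))

  ∑-map : {B : Set} (g : B → A) (xs : List B) (f : A → ℚ) → ∑ (map g xs) f ≡ ∑ xs (f ∘ g)
  ∑-map g xs f = cong sumℚ (sym (List.map-∘ xs))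

  ∑-concatMap : {B : Set} (g : B → List A) (xs : List B) (f : A → ℚ) →
                ∑ (concatMap g xs) f ≡ ∑[ x ∈ xs ] ∑ (g x) f
  ∑-concatMap g []       f = refl
  ∑-concatMap g (x ∷ xs) f = trans (∑-++ (g x) (concatMap g xs) f) (cong (∑ (g x) f +_) (∑-concatMap g xs f))

∑-comm : {A B : Set} (xs : List A) (ys : List B) (f : A → B → ℚ) →
         ∑[ x ∈ xs ] ∑[ y ∈ ys ] f x y ≡ ∑[ y ∈ ys ] ∑[ x ∈ xs ] f x y
∑-comm []       ys f = sym (∑-zero ys (λ _ → refl))
∑-comm (x ∷ xs) ys f = trans (cong (∑ ys (f x) +_) (∑-comm xs ys f))
                             (sym (∑-distrib-+ ys (f x) (λ y → ∑[ x′ ∈ xs ] f x′ y)))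

∑-allFin-suc : ∀ {k} (f : Fin (suc k) → ℚ) → ∑ (allFin (suc k)) f ≡ f Fin.zero + ∑ (allFin k) (f ∘ Fin.suc)
∑-allFin-suc f = cong (λ xs → f Fin.zero + sumℚ xs)
  (trans (List.map-tabulate Fin.suc f) (sym (List.map-tabulate (λ i → i) (f ∘ Fin.suc))))

*-cancelˡ-≡0 : ∀ w x .{{_ : ℚ.NonZero w}} → w * x ≡ 0ℚ → x ≡ 0ℚ
*-cancelˡ-≡0 w x w*x≡0 = begin
  x                ≡⟨ ℚ.*-identityˡ x ⟨
  1ℚ * x           ≡⟨ cong (_* x) (ℚ.*-inverseˡ w) ⟨
  (1/ w * w) * x   ≡⟨ ℚ.*-assoc (1/ w) w x ⟩
  1/ w * (w * x)   ≡⟨ cong (1/ w *_) w*x≡0 ⟩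
  1/ w * 0ℚ        ≡⟨ ℚ.*-zeroʳ (1/ w) ⟩
  0ℚ               ∎
  where open ≡-Reasoning

square-nonNeg : ∀ x → 0ℚ ≤ℚ x * x
square-nonNeg x with ℚ.≤-total 0ℚ x
... | inj₁ 0≤x = ℚ.nonNegative⁻¹ (x * x) {{ℚ.nonNeg*nonNeg⇒nonNeg x {{ℚ.nonNegative 0≤x}} x {{ℚ.nonNegative 0≤x}}}}
... | inj₂ x≤0 = ℚ.nonNegative⁻¹ (x * x) {{ℚ.nonPos*nonPos⇒nonPos x {{ℚ.nonPositive x≤0}} x {{ℚ.nonPositive x≤0}}}}

square-≡0 : ∀ x → x * x ≡ 0ℚ → x ≡ 0ℚ
square-≡0 x x*x≡0 with x ℚ.≟ 0ℚ
... | yes x≡0 = x≡0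
... | no  x≢0 = *-cancelˡ-≡0 x x {{ℚ.≢-nonZero x≢0}} x*x≡0

∑-squares-nonNeg : ∀ {A : Set} (xs : List A) (f : A → ℚ) → 0ℚ ≤ℚ ∑[ x ∈ xs ] (f x * f x)
∑-squares-nonNeg []       f = ℚ.≤-refl
∑-squares-nonNeg (x ∷ xs) f = ℚ.+-mono-≤ (square-nonNeg (f x)) (∑-squares-nonNeg xs f)

nonNeg+nonNeg≡0 : ∀ {a b} → 0ℚ ≤ℚ a → 0ℚ ≤ℚ b → a + b ≡ 0ℚ → a ≡ 0ℚ × b ≡ 0ℚ
nonNeg+nonNeg≡0 {a} {b} 0≤a 0≤b a+b≡0 =
  ℚ.≤-antisym (subst₂ _≤ℚ_ (ℚ.+-identityʳ a) a+b≡0 (ℚ.+-monoʳ-≤ a 0≤b)) 0≤a ,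
  ℚ.≤-antisym (subst₂ _≤ℚ_ (ℚ.+-identityˡ b) a+b≡0 (ℚ.+-monoˡ-≤ b 0≤a)) 0≤b

∑-squares-≡0 : ∀ {A : Set} (xs : List A) (f : A → ℚ) → ∑[ x ∈ xs ] (f x * f x) ≡ 0ℚ → ∀ {x} → x ∈ xs → f x ≡ 0ℚ
∑-squares-≡0 (y ∷ ys) f ∑≡0 (here refl)  =
  square-≡0 (f y) (proj₁ (nonNeg+nonNeg≡0 (square-nonNeg (f y)) (∑-squares-nonNeg ys f) ∑≡0))
∑-squares-≡0 (y ∷ ys) f ∑≡0 (there x∈ys) =
  ∑-squares-≡0 ys f (proj₂ (nonNeg+nonNeg≡0 (square-nonNeg (f y)) (∑-squares-nonNeg ys f) ∑≡0)) x∈ys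

fromℕ : ℕ → ℚ
fromℕ k = ℤ.+ k / 1

fromℕ-+ : ∀ a b → fromℕ (a ℕ.+ b) ≡ fromℕ a + fromℕ b
fromℕ-+ a b
  rewrite ℚ.normalize-coprime {a} {0} (Coprime.sym (1-coprimeTo a))
        | ℚ.normalize-coprime {b} {0} (Coprime.sym (1-coprimeTo b))
        | ℤ.*-identityʳ (ℤ.+ a) | ℤ.*-identityʳ (ℤ.+ b) = refl

fromℕ-∸ : ∀ {a b} → b ≤ a → fromℕ (a ℕ.∸ b) ≡ fromℕ a - fromℕ b
fromℕ-∸ {a} {b} b≤a = begin
  fromℕ (a ℕ.∸ b)                           ≡⟨ x≡[x+y]-y (fromℕ (a ℕ.∸ b)) (fromℕ b) ⟩
  (fromℕ (a ℕ.∸ b) + fromℕ b) - fromℕ b     ≡⟨ cong (_- fromℕ b) (sym (fromℕ-+ (a ℕ.∸ b) b)) ⟩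
  fromℕ (a ℕ.∸ b ℕ.+ b) - fromℕ b           ≡⟨ cong (λ c → fromℕ c - fromℕ b) (ℕ.m∸n+n≡m b≤a) ⟩
  fromℕ a - fromℕ b                         ∎
  where
  open ≡-Reasoning
  x≡[x+y]-y : ∀ x y → x ≡ (x + y) - y
  x≡[x+y]-y = solve-∀ ℚ-ring

fromℕ-nonZero : ∀ k .{{_ : ℕ.NonZero k}} → ℚ.NonZero (fromℕ k)
fromℕ-nonZero (suc k) = ℚ.pos⇒nonZero (fromℕ (suc k)) {{ℚ.normalize-pos (suc k) 1}}

-- Monomials and polynomials

_·_ : ∀ {k} → Mon k → Mon k → Mon k
_·_ = Vec.zipWith ℕ._+_

power : ∀ {k} → Fin k → ℕ → Mon k
power {k} i e = Vec.updateAt (zeroMon k) i (λ _ → e)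

totalDeg-· : ∀ {k} (x y : Mon k) → totalDeg (x · y) ≡ totalDeg x ℕ.+ totalDeg y
totalDeg-· []      []      = refl
totalDeg-· (a ∷ x) (b ∷ y) =
  trans (cong ((a ℕ.+ b) ℕ.+_) (totalDeg-· x y)) (ℕ+.interchange a b (totalDeg x) (totalDeg y))

totalDeg-zeroMon : ∀ k → totalDeg (zeroMon k) ≡ 0
totalDeg-zeroMon zero    = refl
totalDeg-zeroMon (suc k) = totalDeg-zeroMon k

totalDeg-power : ∀ {k} (i : Fin k) e → totalDeg (power i e) ≡ e
totalDeg-power {suc k} Fin.zero    e = trans (cong (e ℕ.+_) (totalDeg-zeroMon k)) (ℕ.+-identityʳ e)
totalDeg-power {suc k} (Fin.suc i) e = totalDeg-power i e

totalDeg-·-power : ∀ {k} (r : Mon k) (i : Fin k) e → totalDeg (r · power i e) ≡ totalDeg r ℕ.+ e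
totalDeg-·-power r i e = trans (totalDeg-· r (power i e)) (cong (totalDeg r ℕ.+_) (totalDeg-power i e))

·-identityʳ : ∀ {k} (x : Mon k) → x · zeroMon k ≡ x
·-identityʳ []      = refl
·-identityʳ (a ∷ x) = cong₂ _∷_ (ℕ.+-identityʳ a) (·-identityʳ x)

powℚ-+ : ∀ q a b → powℚ q (a ℕ.+ b) ≡ powℚ q a * powℚ q b
powℚ-+ q zero    b = sym (ℚ.*-identityˡ (powℚ q b))
powℚ-+ q (suc a) b = trans (cong (q *_) (powℚ-+ q a b)) (sym (ℚ.*-assoc q (powℚ q a) (powℚ q b)))

evalMon-· : ∀ {k} (x y : Mon k) (α : Vec Bool k) → evalMon (x · y) α ≡ evalMon x α * evalMon y α
evalMon-· []      []      []      = refl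
evalMon-· (a ∷ x) (b ∷ y) (β ∷ α) = trans (cong₂ _*_ (powℚ-+ (boolℚ β) a b) (evalMon-· x y α))
                                          (ℚ*.interchange (powℚ (boolℚ β) a) (powℚ (boolℚ β) b) (evalMon x α) (evalMon y α))

evalMon-zeroMon : ∀ {k} (α : Vec Bool k) → evalMon (zeroMon k) α ≡ 1ℚ
evalMon-zeroMon []      = refl
evalMon-zeroMon (β ∷ α) = trans (cong (1ℚ *_) (evalMon-zeroMon α)) (ℚ.*-identityˡ 1ℚ)

evalMon-power : ∀ {k} (i : Fin k) e (α : Vec Bool k) → evalMon (power i e) α ≡ powℚ (boolℚ (Vec.lookup α i)) e
evalMon-power Fin.zero    e (β ∷ α) = trans (cong (powℚ (boolℚ β) e *_) (evalMon-zeroMon α)) (ℚ.*-identityʳ _)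
evalMon-power (Fin.suc i) e (β ∷ α) = trans (ℚ.*-identityˡ _) (evalMon-power i e α)

∑-boolℚ : ∀ {k} (α : Vec Bool k) → ∑[ i ∈ allFin k ] boolℚ (Vec.lookup α i) ≡ fromℕ (countOnes α)
∑-boolℚ []          = refl
∑-boolℚ (true  ∷ α) = trans (∑-allFin-suc (boolℚ ∘ Vec.lookup (true ∷ α)))
                              (trans (cong (1ℚ +_) (∑-boolℚ α)) (sym (fromℕ-+ 1 (countOnes α))))
∑-boolℚ (false ∷ α) = trans (∑-allFin-suc (boolℚ ∘ Vec.lookup (false ∷ α)))
                              (trans (cong (0ℚ +_) (∑-boolℚ α)) (ℚ.+-identityˡ _))

-- monEq branches on does (a ℕ.≟ b), which computes to a ℕ.≡ᵇ b: that is the term to abstract over.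
monEq-reflects : ∀ {k} (x y : Mon k) → Reflects (x ≡ y) (monEq x y)
monEq-reflects []      []      = ofʸ refl
monEq-reflects (a ∷ x) (b ∷ y) with a ℕ.≡ᵇ b in a≡ᵇb
... | false = ofⁿ (λ ax≡by → subst T a≡ᵇb (ℕ.≡⇒≡ᵇ a b (Vec.∷-injectiveˡ ax≡by)))
... | true with ℕ.≡ᵇ⇒≡ a b (subst T (sym a≡ᵇb) tt)
...   | refl with monEq x y | monEq-reflects x y
...     | true  | ofʸ refl = ofʸ refl
...     | false | ofⁿ x≢y  = ofⁿ (x≢y ∘ Vec.∷-injectiveʳ)

δ : ∀ {k} → Mon k → Mon k → ℚ
δ x y = if monEq x y then 1ℚ else 0ℚ

δ-sym : ∀ {k} (x y : Mon k) → δ x y ≡ δ y x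
δ-sym x y with monEq x y | monEq-reflects x y | monEq y x | monEq-reflects y x
... | true  | _        | true  | _        = refl
... | false | _        | false | _        = refl
... | true  | ofʸ x≡y  | false | ofⁿ y≢x  = ⊥-elim (y≢x (sym x≡y))
... | false | ofⁿ x≢y  | true  | ofʸ y≡x  = ⊥-elim (x≢y (sym y≡x))

δ-diag : ∀ {k} (x : Mon k) → δ x x ≡ 1ℚ
δ-diag x with monEq x x | monEq-reflects x x
... | true  | _       = refl
... | false | ofⁿ x≢x = ⊥-elim (x≢x refl)

δ-*-subst : ∀ {k} (x y : Mon k) (G : Mon k → ℚ) → δ x y * G y ≡ δ x y * G x
δ-*-subst x y G with monEq x y | monEq-reflects x y
... | true  | ofʸ refl = refl
... | false | _        = trans (ℚ.*-zeroˡ (G y)) (sym (ℚ.*-zeroˡ (G x)))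

monomial : ∀ {k} → Mon k → Poly k
monomial x = (1ℚ , x) ∷ []

scaleP : ∀ {k} → ℚ → Poly k → Poly k
scaleP a = map (λ (c , x) → (a * c , x))

⟪_,_⟫ : ∀ {k} → Poly k → (Mon k → ℚ) → ℚ
⟪ p , F ⟫ = ∑ p (λ (c , x) → c * F x)

eval : ∀ {k} → Poly k → Vec Bool k → ℚ
eval p α = ⟪ p , (λ x → evalMon x α) ⟫

module _ {k : ℕ} where

  ⟪⟫-cong : (p : Poly k) {F G : Mon k → ℚ} → (∀ x → F x ≡ G x) → ⟪ p , F ⟫ ≡ ⟪ p , G ⟫
  ⟪⟫-cong p F≗G = ∑-cong p (λ (c , x) → cong (c *_) (F≗G x))

  ⟪⟫-++ : (p q : Poly k) (F : Mon k → ℚ) → ⟪ p ++ q , F ⟫ ≡ ⟪ p , F ⟫ + ⟪ q , F ⟫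
  ⟪⟫-++ p q F = ∑-++ p q _

  ⟪⟫-+ : (p : Poly k) (F G : Mon k → ℚ) → ⟪ p , (λ x → F x + G x) ⟫ ≡ ⟪ p , F ⟫ + ⟪ p , G ⟫
  ⟪⟫-+ p F G = trans (∑-cong p (λ (c , x) → ℚ.*-distribˡ-+ c (F x) (G x))) (∑-distrib-+ p _ _)

  ⟪⟫-*ˡ : (p : Poly k) (a : ℚ) (F : Mon k → ℚ) → ⟪ p , (λ x → a * F x) ⟫ ≡ a * ⟪ p , F ⟫
  ⟪⟫-*ˡ p a F = trans (∑-cong p (λ (c , x) → ℚ*.x∙yz≈y∙xz c a (F x))) (sym (*-distribˡ-∑ a p _))

  ⟪⟫-*ʳ : (p : Poly k) (a : ℚ) (F : Mon k → ℚ) → ⟪ p , (λ x → F x * a) ⟫ ≡ ⟪ p , F ⟫ * a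
  ⟪⟫-*ʳ p a F = begin
    ⟪ p , (λ x → F x * a) ⟫ ≡⟨ ⟪⟫-cong p (λ x → ℚ.*-comm (F x) a) ⟩
    ⟪ p , (λ x → a * F x) ⟫ ≡⟨ ⟪⟫-*ˡ p a F ⟩
    a * ⟪ p , F ⟫           ≡⟨ ℚ.*-comm a _ ⟩
    ⟪ p , F ⟫ * a           ∎
    where open ≡-Reasoning

  ⟪⟫-scaleP : (a : ℚ) (p : Poly k) (F : Mon k → ℚ) → ⟪ scaleP a p , F ⟫ ≡ a * ⟪ p , F ⟫
  ⟪⟫-scaleP a p F = begin
    ⟪ scaleP a p , F ⟫              ≡⟨ ∑-map _ p _ ⟩
    ∑ p (λ (c , x) → (a * c) * F x) ≡⟨ ∑-cong p (λ (c , x) → ℚ.*-assoc a c (F x)) ⟩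
    ∑ p (λ (c , x) → a * (c * F x)) ≡⟨ *-distribˡ-∑ a p _ ⟨
    a * ⟪ p , F ⟫                   ∎
    where open ≡-Reasoning

  ⟪⟫-*P : (p q : Poly k) (F : Mon k → ℚ) →
          ⟪ p *P q , F ⟫ ≡ ⟪ p , (λ x → ⟪ q , (λ y → F (x · y)) ⟫) ⟫
  ⟪⟫-*P p q F = trans (∑-concatMap _ p _) (∑-cong p (λ (a , x) →
    trans (∑-map _ q _) (trans (∑-cong q (λ (b , y) → ℚ.*-assoc a b (F (x · y))))
                               (sym (*-distribˡ-∑ a q _)))))

  coeff-⟪⟫ : (p : Poly k) (m : Mon k) → coeff p m ≡ ⟪ p , (λ x → δ x m) ⟫
  coeff-⟪⟫ []            m = refl
  coeff-⟪⟫ ((c , x) ∷ p) m with monEq x m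
  ... | true  = cong₂ _+_ (sym (ℚ.*-identityʳ c)) (coeff-⟪⟫ p m)
  ... | false = trans (sym (ℚ.+-identityˡ (coeff p m))) (cong₂ _+_ (sym (ℚ.*-zeroʳ c)) (coeff-⟪⟫ p m))

  ⟪⟫-δ : (p : Poly k) (x : Mon k) (G : Mon k → ℚ) → ⟪ p , (λ y → δ x y * G y) ⟫ ≡ coeff p x * G x
  ⟪⟫-δ p x G = begin
    ⟪ p , (λ y → δ x y * G y) ⟫ ≡⟨ ⟪⟫-cong p (λ y → trans (δ-*-subst x y G) (cong (_* G x) (δ-sym x y))) ⟩
    ⟪ p , (λ y → δ y x * G x) ⟫ ≡⟨ ⟪⟫-*ʳ p (G x) (λ y → δ y x) ⟩
    ⟪ p , (λ y → δ y x) ⟫ * G x ≡⟨ cong (_* G x) (coeff-⟪⟫ p x) ⟨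
    coeff p x * G x             ∎
    where open ≡-Reasoning

  coeff-++ : (p q : Poly k) (m : Mon k) → coeff (p ++ q) m ≡ coeff p m + coeff q m
  coeff-++ p q m = begin
    coeff (p ++ q) m                              ≡⟨ coeff-⟪⟫ (p ++ q) m ⟩
    ⟪ p ++ q , (λ x → δ x m) ⟫                    ≡⟨ ⟪⟫-++ p q _ ⟩
    ⟪ p , (λ x → δ x m) ⟫ + ⟪ q , (λ x → δ x m) ⟫ ≡⟨ cong₂ _+_ (coeff-⟪⟫ p m) (coeff-⟪⟫ q m) ⟨
    coeff p m + coeff q m                         ∎
    where open ≡-Reasoning

  coeff-scaleP-*P : (a : ℚ) (p q : Poly k) (m : Mon k) → coeff (scaleP a p *P q) m ≡ a * coeff (p *P q) m
  coeff-scaleP-*P a p q m = begin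
    coeff (scaleP a p *P q) m                                     ≡⟨ coeff-⟪⟫ (scaleP a p *P q) m ⟩
    ⟪ scaleP a p *P q , (λ x → δ x m) ⟫                           ≡⟨ ⟪⟫-*P (scaleP a p) q _ ⟩
    ⟪ scaleP a p , (λ x → ⟪ q , (λ y → δ (x · y) m) ⟫) ⟫          ≡⟨ ⟪⟫-scaleP a p _ ⟩
    a * ⟪ p , (λ x → ⟪ q , (λ y → δ (x · y) m) ⟫) ⟫               ≡⟨ cong (a *_) (⟪⟫-*P p q _) ⟨
    a * ⟪ p *P q , (λ x → δ x m) ⟫                                ≡⟨ cong (a *_) (coeff-⟪⟫ (p *P q) m) ⟨
    a * coeff (p *P q) m                                          ∎
    where open ≡-Reasoning

  coeff-monomial-*P : (r : Mon k) (q : Poly k) (m : Mon k) → coeff (monomial r *P q) m ≡ ⟪ q , (λ y → δ (r · y) m) ⟫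
  coeff-monomial-*P r q m = begin
    coeff (monomial r *P q) m                      ≡⟨ coeff-⟪⟫ (monomial r *P q) m ⟩
    ⟪ monomial r *P q , (λ x → δ x m) ⟫            ≡⟨ ⟪⟫-*P (monomial r) q _ ⟩
    1ℚ * ⟪ q , (λ y → δ (r · y) m) ⟫ + 0ℚ          ≡⟨ ℚ.+-identityʳ _ ⟩
    1ℚ * ⟪ q , (λ y → δ (r · y) m) ⟫               ≡⟨ ℚ.*-identityˡ _ ⟩
    ⟪ q , (λ y → δ (r · y) m) ⟫                    ∎
    where open ≡-Reasoning

-- If every coefficient of r vanishes then ⟪ r , F ⟫ = 0: multiplying F by avoid xs = ∏_{x ∈ xs} (1 − δ x ·)
-- changes ⟪ r , F ⟫ by multiples of coeff r x = 0, and for xs the monomials of r it kills every term.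
avoid : ∀ {k} → List (Mon k) → Mon k → ℚ
avoid []       y = 1ℚ
avoid (x ∷ xs) y = (1ℚ - δ x y) * avoid xs y

avoid-∈ : ∀ {k} {xs : List (Mon k)} {y} → y ∈ xs → avoid xs y ≡ 0ℚ
avoid-∈ {xs = x ∷ xs} (here refl) = trans (cong (λ e → (1ℚ - e) * avoid xs x) (δ-diag x)) (ℚ.*-zeroˡ (avoid xs x))
avoid-∈ {xs = x ∷ xs} {y} (there y∈xs) = trans (cong ((1ℚ - δ x y) *_) (avoid-∈ y∈xs)) (ℚ.*-zeroʳ (1ℚ - δ x y))

module _ {k : ℕ} (r : Poly k) (r≈0 : ∀ m → coeff r m ≡ 0ℚ) where

  ⟪⟫-avoid : (xs : List (Mon k)) (F : Mon k → ℚ) → ⟪ r , (λ y → avoid xs y * F y) ⟫ ≡ ⟪ r , F ⟫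
  ⟪⟫-avoid []       F = ⟪⟫-cong r (λ y → ℚ.*-identityˡ (F y))
  ⟪⟫-avoid (x ∷ xs) F = begin
    ⟪ r , (λ y → ((1ℚ - δ x y) * avoid xs y) * F y) ⟫  ≡⟨ ⟪⟫-cong r (λ y → expand (δ x y) (avoid xs y) (F y)) ⟩
    ⟪ r , (λ y → G y + (- 1ℚ) * (δ x y * G y)) ⟫      ≡⟨ ⟪⟫-+ r G _ ⟩
    ⟪ r , G ⟫ + ⟪ r , (λ y → (- 1ℚ) * (δ x y * G y)) ⟫ ≡⟨ cong (⟪ r , G ⟫ +_) (⟪⟫-*ˡ r (- 1ℚ) _) ⟩
    ⟪ r , G ⟫ + (- 1ℚ) * ⟪ r , (λ y → δ x y * G y) ⟫   ≡⟨ cong (λ e → ⟪ r , G ⟫ + (- 1ℚ) * e) (⟪⟫-δ r x G) ⟩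
    ⟪ r , G ⟫ + (- 1ℚ) * (coeff r x * G x)             ≡⟨ cong (λ e → ⟪ r , G ⟫ + (- 1ℚ) * (e * G x)) (r≈0 x) ⟩
    ⟪ r , G ⟫ + (- 1ℚ) * (0ℚ * G x)                   ≡⟨ x+-1*[0*y]≡x ⟪ r , G ⟫ (G x) ⟩
    ⟪ r , G ⟫                                          ≡⟨ ⟪⟫-avoid xs F ⟩
    ⟪ r , F ⟫                                          ∎
    where
    open ≡-Reasoning
    G : Mon k → ℚ
    G y = avoid xs y * F y
    expand : ∀ d a f → ((1ℚ - d) * a) * f ≡ a * f + (- 1ℚ) * (d * (a * f))
    expand = solve-∀ ℚ-ring
    x+-1*[0*y]≡x : ∀ x y → x + (- 1ℚ) * (0ℚ * y) ≡ x
    x+-1*[0*y]≡x = solve-∀ ℚ-ring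

  ⟪⟫-vanishes : (F : Mon k → ℚ) → ⟪ r , F ⟫ ≡ 0ℚ
  ⟪⟫-vanishes F = begin
    ⟪ r , F ⟫                                 ≡⟨ ⟪⟫-avoid (map proj₂ r) F ⟨
    ⟪ r , (λ y → avoid (map proj₂ r) y * F y) ⟫ ≡⟨ ∑-cong-∈ r killed ⟩
    ∑ r (λ _ → 0ℚ)                            ≡⟨ ∑-zero r (λ _ → refl) ⟩
    0ℚ                                        ∎
    where
    open ≡-Reasoning
    killed : ∀ {t} → t ∈ r → proj₁ t * (avoid (map proj₂ r) (proj₂ t) * F (proj₂ t)) ≡ 0ℚ
    killed {c , x} t∈r = begin
      c * (avoid (map proj₂ r) x * F x) ≡⟨ cong (λ e → c * (e * F x)) (avoid-∈ (∈-map⁺ proj₂ t∈r)) ⟩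
      c * (0ℚ * F x)                    ≡⟨ cong (c *_) (ℚ.*-zeroˡ (F x)) ⟩
      c * 0ℚ                            ≡⟨ ℚ.*-zeroʳ c ⟩
      0ℚ                                ∎

⟪⟫-resp-≈P : ∀ {k} {p q : Poly k} → p ≈P q → (F : Mon k → ℚ) → ⟪ p , F ⟫ ≡ ⟪ q , F ⟫
⟪⟫-resp-≈P {p = p} {q} p≈q F = x+-1*y≡0⇒x≡y (begin
  ⟪ p , F ⟫ + (- 1ℚ) * ⟪ q , F ⟫    ≡⟨ cong (⟪ p , F ⟫ +_) (⟪⟫-scaleP (- 1ℚ) q F) ⟨
  ⟪ p , F ⟫ + ⟪ scaleP (- 1ℚ) q , F ⟫ ≡⟨ ⟪⟫-++ p (scaleP (- 1ℚ) q) F ⟨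
  ⟪ p ++ scaleP (- 1ℚ) q , F ⟫       ≡⟨ ⟪⟫-vanishes (p ++ scaleP (- 1ℚ) q) difference≈0 F ⟩
  0ℚ                                ∎)
  where
  open ≡-Reasoning
  x+-1*y≡0⇒x≡y : ∀ {x y} → x + (- 1ℚ) * y ≡ 0ℚ → x ≡ y
  x+-1*y≡0⇒x≡y {x} {y} e = trans (x≡[x+-1*y]+y x y) (trans (cong (_+ y) e) (ℚ.+-identityˡ y))
    where
    x≡[x+-1*y]+y : ∀ x y → x ≡ (x + (- 1ℚ) * y) + y
    x≡[x+-1*y]+y = solve-∀ ℚ-ring
  difference≈0 : ∀ m → coeff (p ++ scaleP (- 1ℚ) q) m ≡ 0ℚ
  difference≈0 m = begin
    coeff (p ++ scaleP (- 1ℚ) q) m                          ≡⟨ coeff-++ p _ m ⟩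
    coeff p m + coeff (scaleP (- 1ℚ) q) m                    ≡⟨ cong (coeff p m +_) (coeff-⟪⟫ (scaleP (- 1ℚ) q) m) ⟩
    coeff p m + ⟪ scaleP (- 1ℚ) q , (λ x → δ x m) ⟫         ≡⟨ cong (coeff p m +_) (⟪⟫-scaleP (- 1ℚ) q _) ⟩
    coeff p m + (- 1ℚ) * ⟪ q , (λ x → δ x m) ⟫              ≡⟨ cong (λ e → coeff p m + (- 1ℚ) * e) (coeff-⟪⟫ q m) ⟨
    coeff p m + (- 1ℚ) * coeff q m                           ≡⟨ cong (λ e → e + (- 1ℚ) * coeff q m) (p≈q m) ⟩
    coeff q m + (- 1ℚ) * coeff q m                           ≡⟨ x+-1*x≡0 (coeff q m) ⟩
    0ℚ                                                       ∎
    where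
    x+-1*x≡0 : ∀ x → x + (- 1ℚ) * x ≡ 0ℚ
    x+-1*x≡0 = solve-∀ ℚ-ring

eval-*P : ∀ {k} (p q : Poly k) (α : Vec Bool k) → eval (p *P q) α ≡ eval p α * eval q α
eval-*P p q α = begin
  eval (p *P q) α                                ≡⟨ ⟪⟫-*P p q _ ⟩
  ⟪ p , (λ x → ⟪ q , (λ y → e (x · y)) ⟫) ⟫      ≡⟨ ⟪⟫-cong p (λ x → ⟪⟫-cong q (λ y → evalMon-· x y α)) ⟩
  ⟪ p , (λ x → ⟪ q , (λ y → e x * e y) ⟫) ⟫      ≡⟨ ⟪⟫-cong p (λ x → ⟪⟫-*ˡ q (e x) e) ⟩
  ⟪ p , (λ x → e x * eval q α) ⟫                 ≡⟨ ⟪⟫-*ʳ p (eval q α) e ⟩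
  eval p α * eval q α                            ∎
  where
  open ≡-Reasoning
  e = λ x → evalMon x α

module _ (n : ℕ) where

  ⟪⟫-square : (i : Fin (2 ℕ.* n)) (G : Mon (2 ℕ.* n) → ℚ) →
              ⟪ genPoly n (inj₁ i) , G ⟫ ≡ G (sqMon i) - G (varMon i)
  ⟪⟫-square i G = simplify (G (sqMon i)) (G (varMon i))
    where
    simplify : ∀ a b → 1ℚ * a + ((- 1ℚ) * b + 0ℚ) ≡ a - b
    simplify = solve-∀ ℚ-ring

  ⟪⟫-sum : (G : Mon (2 ℕ.* n) → ℚ) →
           ⟪ genPoly n (inj₂ tt) , G ⟫ ≡ ∑[ i ∈ allFin (2 ℕ.* n) ] G (varMon i) - fromℕ n * G (zeroMon _)
  ⟪⟫-sum G = begin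
    ⟪ genPoly n (inj₂ tt) , G ⟫
      ≡⟨ ⟪⟫-++ (map (λ i → (1ℚ , varMon i)) (allFin _)) (const (- fromℕ n)) G ⟩
    ⟪ map (λ i → (1ℚ , varMon i)) (allFin _) , G ⟫ + ((- fromℕ n) * G (zeroMon _) + 0ℚ)
      ≡⟨ cong₂ _+_ (trans (∑-map (λ i → (1ℚ , varMon i)) (allFin _) (λ (c , x) → c * G x))
                          (∑-cong (allFin _) (λ i → ℚ.*-identityˡ (G (varMon i)))))
                   (trans (ℚ.+-identityʳ _) (sym (ℚ.neg-distribˡ-* (fromℕ n) (G (zeroMon _))))) ⟩
    ∑[ i ∈ allFin (2 ℕ.* n) ] G (varMon i) - fromℕ n * G (zeroMon _)
      ∎
    where open ≡-Reasoning

  eval-genPoly : ∀ g {α : Vec Bool (2 ℕ.* n)} → countOnes α ≡ n → eval (genPoly n g) α ≡ 0ℚ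
  eval-genPoly (inj₁ i) {α} _ = begin
    eval (genPoly n (inj₁ i)) α                        ≡⟨ ⟪⟫-square i (λ x → evalMon x α) ⟩
    evalMon (sqMon i) α - evalMon (varMon i) α         ≡⟨ cong₂ _-_ (evalMon-power i 2 α) (evalMon-power i 1 α) ⟩
    powℚ (boolℚ αᵢ) 2 - powℚ (boolℚ αᵢ) 1              ≡⟨ idempotent αᵢ ⟩
    0ℚ                                                 ∎
    where
    open ≡-Reasoning
    αᵢ = Vec.lookup α i
    idempotent : ∀ b → powℚ (boolℚ b) 2 - powℚ (boolℚ b) 1 ≡ 0ℚ
    idempotent true  = refl
    idempotent false = refl
  eval-genPoly (inj₂ tt) {α} |α|≡n = begin
    eval (genPoly n (inj₂ tt)) α
      ≡⟨ ⟪⟫-sum (λ x → evalMon x α) ⟩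
    ∑[ i ∈ allFin _ ] evalMon (varMon i) α - fromℕ n * evalMon (zeroMon _) α
      ≡⟨ cong₂ (λ a b → a - fromℕ n * b) (∑-cong (allFin _) (λ i → trans (evalMon-power i 1 α) (ℚ.*-identityʳ _)))
                                         (evalMon-zeroMon α) ⟩
    ∑[ i ∈ allFin _ ] boolℚ (Vec.lookup α i) - fromℕ n * 1ℚ
      ≡⟨ cong₂ (λ a b → a - b) (trans (∑-boolℚ α) (cong fromℕ |α|≡n)) (ℚ.*-identityʳ (fromℕ n)) ⟩
    fromℕ n - fromℕ n
      ≡⟨ ℚ.+-inverseʳ (fromℕ n) ⟩
    0ℚ ∎
    where open ≡-Reasoning

  eval-combine : ∀ ds {α : Vec Bool (2 ℕ.* n)} → countOnes α ≡ n → eval (combine n ds) α ≡ 0ℚ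
  eval-combine []              _     = refl
  eval-combine ((lam , g) ∷ ds) {α} |α|≡n = begin
    eval ((lam *P genPoly n g) ++ combine n ds) α
      ≡⟨ ⟪⟫-++ (lam *P genPoly n g) (combine n ds) _ ⟩
    eval (lam *P genPoly n g) α + eval (combine n ds) α
      ≡⟨ cong₂ _+_ (eval-*P lam (genPoly n g) α) (eval-combine ds |α|≡n) ⟩
    eval lam α * eval (genPoly n g) α + 0ℚ
      ≡⟨ cong (λ e → eval lam α * e + 0ℚ) (eval-genPoly g |α|≡n) ⟩
    eval lam α * 0ℚ + 0ℚ
      ≡⟨ cong (_+ 0ℚ) (ℚ.*-zeroʳ (eval lam α)) ⟩
    0ℚ ∎
    where open ≡-Reasoning

  square-degree : (i : Fin (2 ℕ.* n)) → All (λ (c , y) → totalDeg y ≤ 2) (genPoly n (inj₁ i))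
  square-degree i = ℕ.≤-reflexive (totalDeg-power i 2) ∷ ℕ.≤-trans (ℕ.≤-reflexive (totalDeg-power i 1)) (ℕ.n≤1+n 1) ∷ []

  sum-degree : All (λ (c , y) → totalDeg y ≤ 1) (genPoly n (inj₂ tt))
  sum-degree = All.++⁺ (All.map⁺ (All.universal (λ i → ℕ.≤-reflexive (totalDeg-power i 1)) (allFin _)))
                       (ℕ.≤-trans (ℕ.≤-reflexive (totalDeg-zeroMon (2 ℕ.* n))) z≤n ∷ [])

DegLe-All : ∀ {k} (p : Poly k) {d} → All (λ (c , x) → totalDeg x ≤ d) p → DegLe p d
DegLe-All []            []        m c≢0 = ⊥-elim (c≢0 refl)
DegLe-All ((c , x) ∷ p) (x≤d ∷ p≤d) m c≢0 with monEq x m | monEq-reflects x m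
... | true  | ofʸ refl = x≤d
... | false | _        = DegLe-All p p≤d m c≢0

DegLe-monomial-*P : ∀ {k} (r : Mon k) (q : Poly k) {e d} → All (λ (c , y) → totalDeg y ≤ e) q →
                    totalDeg r ℕ.+ e ≤ d → DegLe (monomial r *P q) d
DegLe-monomial-*P r q {e} {d} q≤e r+e≤d = DegLe-All (monomial r *P q)
  (All.++⁺ (All.map⁺ (All.map (λ {(c , y)} y≤e → bound y y≤e) q≤e)) [])
  where
  bound : ∀ y → totalDeg y ≤ e → totalDeg (r · y) ≤ d
  bound y y≤e = subst (_≤ d) (sym (totalDeg-· r y)) (ℕ.≤-trans (ℕ.+-monoʳ-≤ (totalDeg r) y≤e) r+e≤d)

-- Congruence modulo degree-d derivations

Coeffs : ℕ → Set
Coeffs k = Mon k → ℚ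

infixl 6 _⊕_
infixr 7 _⊛_

_⊕_ : ∀ {k} → Coeffs k → Coeffs k → Coeffs k
(F ⊕ G) x = F x + G x

_⊛_ : ∀ {k} → ℚ → Coeffs k → Coeffs k
(a ⊛ F) x = a * F x

𝟘 : ∀ {k} → Coeffs k
𝟘 _ = 0ℚ

⨁ : ∀ {A : Set} {k} → List A → (A → Coeffs k) → Coeffs k
⨁ xs F x = ∑[ a ∈ xs ] F a x

syntax ⨁ xs (λ a → F) = ⨁[ a ∈ xs ] F

module Modulo (n d : ℕ) where

  Steps : Set
  Steps = List (Poly (2 ℕ.* n) × Gen n)

  Admissible : Steps → Set
  Admissible ds = ∀ {lam g} → (lam , g) ∈ ds → DegLe (lam *P genPoly n g) d

  scaleSteps : ℚ → Steps → Steps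
  scaleSteps a = map (λ (lam , g) → (scaleP a lam , g))

  coeff-combine-++ : ∀ ds es → coeff (combine n (ds ++ es)) ≗ coeff (combine n ds) ⊕ coeff (combine n es)
  coeff-combine-++ []               es m = sym (ℚ.+-identityˡ _)
  coeff-combine-++ ((lam , g) ∷ ds) es m = begin
    coeff (lam *P genPoly n g ++ combine n (ds ++ es)) m       ≡⟨ coeff-++ (lam *P genPoly n g) _ m ⟩
    coeff (lam *P genPoly n g) m + coeff (combine n (ds ++ es)) m
      ≡⟨ cong (coeff (lam *P genPoly n g) m +_) (coeff-combine-++ ds es m) ⟩
    coeff (lam *P genPoly n g) m + (coeff (combine n ds) m + coeff (combine n es) m)
      ≡⟨ ℚ.+-assoc (coeff (lam *P genPoly n g) m) (coeff (combine n ds) m) (coeff (combine n es) m) ⟨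
    (coeff (lam *P genPoly n g) m + coeff (combine n ds) m) + coeff (combine n es) m
      ≡⟨ cong (_+ coeff (combine n es) m) (coeff-++ (lam *P genPoly n g) (combine n ds) m) ⟨
    coeff (lam *P genPoly n g ++ combine n ds) m + coeff (combine n es) m ∎
    where open ≡-Reasoning

  coeff-combine-scale : ∀ a ds → coeff (combine n (scaleSteps a ds)) ≗ a ⊛ coeff (combine n ds)
  coeff-combine-scale a []               m = sym (ℚ.*-zeroʳ a)
  coeff-combine-scale a ((lam , g) ∷ ds) m = begin
    coeff (scaleP a lam *P genPoly n g ++ combine n (scaleSteps a ds)) m
      ≡⟨ coeff-++ (scaleP a lam *P genPoly n g) _ m ⟩
    coeff (scaleP a lam *P genPoly n g) m + coeff (combine n (scaleSteps a ds)) m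
      ≡⟨ cong₂ _+_ (coeff-scaleP-*P a lam (genPoly n g) m) (coeff-combine-scale a ds m) ⟩
    a * coeff (lam *P genPoly n g) m + a * coeff (combine n ds) m
      ≡⟨ ℚ.*-distribˡ-+ a _ _ ⟨
    a * (coeff (lam *P genPoly n g) m + coeff (combine n ds) m)
      ≡⟨ cong (a *_) (coeff-++ (lam *P genPoly n g) (combine n ds) m) ⟨
    a * coeff (lam *P genPoly n g ++ combine n ds) m ∎
    where open ≡-Reasoning

  Admissible-++ : ∀ ds es → Admissible ds → Admissible es → Admissible (ds ++ es)
  Admissible-++ ds es ds-ok es-ok ∈ds++es with ∈-++⁻ ds ∈ds++es
  ... | inj₁ ∈ds = ds-ok ∈ds
  ... | inj₂ ∈es = es-ok ∈es

  Admissible-scale : ∀ a ds → Admissible ds → Admissible (scaleSteps a ds)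
  Admissible-scale a ds ds-ok ∈ds′ with ∈-map⁻ (λ (lam , g) → (scaleP a lam , g)) ∈ds′
  ... | (lam , g) , ∈ds , refl = λ m c≢0 → ds-ok ∈ds m (λ c≡0 →
    c≢0 (trans (coeff-scaleP-*P a lam (genPoly n g) m) (trans (cong (a *_) c≡0) (ℚ.*-zeroʳ a))))

  infix 4 _∼_

  record _∼_ (F G : Coeffs (2 ℕ.* n)) : Set where
    constructor derive
    field
      steps      : Steps
      difference : F ≗ G ⊕ coeff (combine n steps)
      admissible : Admissible steps

  ≗⇒∼ : ∀ {F G} → F ≗ G → F ∼ G
  ≗⇒∼ F≗G = derive [] (λ m → trans (F≗G m) (sym (ℚ.+-identityʳ _))) (λ ())

  ∼-refl : ∀ {F} → F ∼ F
  ∼-refl = ≗⇒∼ (λ _ → refl)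

  ∼-sym : ∀ {F G} → F ∼ G → G ∼ F
  ∼-sym {F} {G} (derive ds F≗G+C ok) = derive (scaleSteps (- 1ℚ) ds) G≗F-C (Admissible-scale (- 1ℚ) ds ok)
    where
    G≗F-C : G ≗ F ⊕ coeff (combine n (scaleSteps (- 1ℚ) ds))
    G≗F-C m = begin
      G m                                          ≡⟨ y≡[y+c]+-1*c (G m) (coeff (combine n ds) m) ⟩
      (G m + coeff (combine n ds) m) + (- 1ℚ) * coeff (combine n ds) m
        ≡⟨ cong₂ _+_ (F≗G+C m) (coeff-combine-scale (- 1ℚ) ds m) ⟨
      F m + coeff (combine n (scaleSteps (- 1ℚ) ds)) m ∎
      where
      open ≡-Reasoning
      y≡[y+c]+-1*c : ∀ y c → y ≡ (y + c) + (- 1ℚ) * c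
      y≡[y+c]+-1*c = solve-∀ ℚ-ring

  ∼-trans : ∀ {F G H} → F ∼ G → G ∼ H → F ∼ H
  ∼-trans {F} {G} {H} (derive ds F≗G+C ds-ok) (derive es G≗H+D es-ok) =
    derive (ds ++ es) F≗H+D+C (Admissible-++ ds es ds-ok es-ok)
    where
    F≗H+D+C : F ≗ H ⊕ coeff (combine n (ds ++ es))
    F≗H+D+C m = begin
      F m                                                    ≡⟨ F≗G+C m ⟩
      G m + coeff (combine n ds) m                            ≡⟨ cong (_+ coeff (combine n ds) m) (G≗H+D m) ⟩
      (H m + coeff (combine n es) m) + coeff (combine n ds) m ≡⟨ xy∙z≈x∙zy (H m) _ _ ⟩
      H m + (coeff (combine n ds) m + coeff (combine n es) m) ≡⟨ cong (H m +_) (coeff-combine-++ ds es m) ⟨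
      H m + coeff (combine n (ds ++ es)) m                    ∎
      where
      open ≡-Reasoning
      open ℚ+ using (xy∙z≈x∙zy)

  ∼-setoid : Setoid _ _
  ∼-setoid = record
    { Carrier       = Coeffs (2 ℕ.* n)
    ; _≈_           = _∼_
    ; isEquivalence = record { refl = ∼-refl ; sym = ∼-sym ; trans = ∼-trans }
    }

  module ∼-Reasoning = Relation.Binary.Reasoning.Setoid ∼-setoid

  ⊕-cong : ∀ {F₁ G₁ F₂ G₂} → F₁ ∼ G₁ → F₂ ∼ G₂ → F₁ ⊕ F₂ ∼ G₁ ⊕ G₂
  ⊕-cong {F₁} {G₁} {F₂} {G₂} (derive ds F₁≗G₁+C ds-ok) (derive es F₂≗G₂+D es-ok) =
    derive (ds ++ es) sum≗ (Admissible-++ ds es ds-ok es-ok)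
    where
    sum≗ : F₁ ⊕ F₂ ≗ G₁ ⊕ G₂ ⊕ coeff (combine n (ds ++ es))
    sum≗ m = begin
      F₁ m + F₂ m
        ≡⟨ cong₂ _+_ (F₁≗G₁+C m) (F₂≗G₂+D m) ⟩
      (G₁ m + coeff (combine n ds) m) + (G₂ m + coeff (combine n es) m)
        ≡⟨ ℚ+.interchange (G₁ m) (coeff (combine n ds) m) (G₂ m) (coeff (combine n es) m) ⟩
      (G₁ m + G₂ m) + (coeff (combine n ds) m + coeff (combine n es) m)
        ≡⟨ cong (G₁ m + G₂ m +_) (coeff-combine-++ ds es m) ⟨
      (G₁ m + G₂ m) + coeff (combine n (ds ++ es)) m ∎
      where open ≡-Reasoning

  ⊛-cong : ∀ a {F G} → F ∼ G → a ⊛ F ∼ a ⊛ G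
  ⊛-cong a {F} {G} (derive ds F≗G+C ok) = derive (scaleSteps a ds) scaled (Admissible-scale a ds ok)
    where
    scaled : a ⊛ F ≗ a ⊛ G ⊕ coeff (combine n (scaleSteps a ds))
    scaled m = begin
      a * F m                                  ≡⟨ cong (a *_) (F≗G+C m) ⟩
      a * (G m + coeff (combine n ds) m)       ≡⟨ ℚ.*-distribˡ-+ a _ _ ⟩
      a * G m + a * coeff (combine n ds) m     ≡⟨ cong (a * G m +_) (coeff-combine-scale a ds m) ⟨
      a * G m + coeff (combine n (scaleSteps a ds)) m ∎
      where open ≡-Reasoning

  ⨁-cong : ∀ {A : Set} (xs : List A) {F G : A → Coeffs (2 ℕ.* n)} → (∀ x → F x ∼ G x) → ⨁ xs F ∼ ⨁ xs G
  ⨁-cong []       F∼G = ∼-refl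
  ⨁-cong (x ∷ xs) F∼G = ⊕-cong (F∼G x) (⨁-cong xs F∼G)

  ∼-from-difference : ∀ {F G} → (λ m → F m - G m) ∼ 𝟘 → F ∼ G
  ∼-from-difference {F} {G} F-G∼𝟘 = begin
    F                        ≈⟨ ≗⇒∼ (λ m → x≡[x-y]+y (F m) (G m)) ⟩
    (λ m → F m - G m) ⊕ G    ≈⟨ ⊕-cong F-G∼𝟘 ∼-refl ⟩
    𝟘 ⊕ G                    ≈⟨ ≗⇒∼ (λ m → ℚ.+-identityˡ (G m)) ⟩
    G                        ∎
    where
    open ∼-Reasoning
    x≡[x-y]+y : ∀ x y → x ≡ (x - y) + y
    x≡[x-y]+y = solve-∀ ℚ-ring

  step∼𝟘 : ∀ lam g → DegLe (lam *P genPoly n g) d → coeff (lam *P genPoly n g) ∼ 𝟘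
  step∼𝟘 lam g ok = derive ((lam , g) ∷ []) single λ { (here refl) → ok }
    where
    single : coeff (lam *P genPoly n g) ≗ 𝟘 ⊕ coeff (combine n ((lam , g) ∷ []))
    single m = begin
      coeff (lam *P genPoly n g) m                    ≡⟨ ℚ.+-identityʳ _ ⟨
      coeff (lam *P genPoly n g) m + 0ℚ               ≡⟨ coeff-++ (lam *P genPoly n g) [] m ⟨
      coeff (lam *P genPoly n g ++ []) m              ≡⟨ ℚ.+-identityˡ _ ⟨
      0ℚ + coeff (combine n ((lam , g) ∷ [])) m       ∎
      where open ≡-Reasoning

  ∼𝟘⇒Derivation : ∀ p → coeff p ∼ 𝟘 → Derivation n p d
  ∼𝟘⇒Derivation p (derive ds p≗0+C ok) = ds , (λ m → trans (p≗0+C m) (ℚ.+-identityˡ _)) , ok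

  square-step : ∀ r i → totalDeg r ℕ.+ 2 ≤ d → δ (r · sqMon i) ∼ δ (r · varMon i)
  square-step r i deg = ∼-from-difference (∼-trans (≗⇒∼ coeff≗) (step∼𝟘 (monomial r) (inj₁ i) admissible))
    where
    coeff≗ : (λ m → δ (r · sqMon i) m - δ (r · varMon i) m) ≗ coeff (monomial r *P genPoly n (inj₁ i))
    coeff≗ m = sym (trans (coeff-monomial-*P r (genPoly n (inj₁ i)) m) (⟪⟫-square n i (λ y → δ (r · y) m)))
    admissible = DegLe-monomial-*P r (genPoly n (inj₁ i)) (square-degree n i) deg

  sum-step : ∀ r → totalDeg r ℕ.+ 1 ≤ d → ⨁[ i ∈ allFin (2 ℕ.* n) ] δ (r · varMon i) ∼ fromℕ n ⊛ δ r
  sum-step r deg = ∼-from-difference (∼-trans (≗⇒∼ coeff≗) (step∼𝟘 (monomial r) (inj₂ tt) admissible))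
    where
    coeff≗ : (λ m → ∑[ i ∈ allFin _ ] δ (r · varMon i) m - fromℕ n * δ r m) ≗ coeff (monomial r *P genPoly n (inj₂ tt))
    coeff≗ m = sym (begin
      coeff (monomial r *P genPoly n (inj₂ tt)) m
        ≡⟨ coeff-monomial-*P r (genPoly n (inj₂ tt)) m ⟩
      ⟪ genPoly n (inj₂ tt) , (λ y → δ (r · y) m) ⟫
        ≡⟨ ⟪⟫-sum n (λ y → δ (r · y) m) ⟩
      ∑[ i ∈ allFin _ ] δ (r · varMon i) m - fromℕ n * δ (r · zeroMon _) m
        ≡⟨ cong (λ x → ∑[ i ∈ allFin _ ] δ (r · varMon i) m - fromℕ n * δ x m) (·-identityʳ r) ⟩
      ∑[ i ∈ allFin _ ] δ (r · varMon i) m - fromℕ n * δ r m ∎)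
      where open ≡-Reasoning
    admissible = DegLe-monomial-*P r (genPoly n (inj₂ tt)) (sum-degree n) deg

  eval-resp-∼ : ∀ p q → coeff p ∼ coeff q → ∀ {α} → countOnes α ≡ n → eval p α ≡ eval q α
  eval-resp-∼ p q (derive ds p≗q+C _) {α} |α|≡n = begin
    eval p α                          ≡⟨ ⟪⟫-resp-≈P {p = p} {q ++ combine n ds} p≈q+C (λ x → evalMon x α) ⟩
    eval (q ++ combine n ds) α        ≡⟨ ⟪⟫-++ q (combine n ds) (λ x → evalMon x α) ⟩
    eval q α + eval (combine n ds) α  ≡⟨ cong (eval q α +_) (eval-combine n ds |α|≡n) ⟩
    eval q α + 0ℚ                     ≡⟨ ℚ.+-identityʳ _ ⟩
    eval q α                          ∎
    where
    open ≡-Reasoning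
    p≈q+C : p ≈P (q ++ combine n ds)
    p≈q+C m = trans (p≗q+C m) (sym (coeff-++ q (combine n ds) m))

-- Subset sums on the Boolean cube

-- sumSubsets β A = ∑_{X ⊆ β} A X, subsets being characteristic vectors.
sumSubsets : ∀ {k} → Vec Bool k → (Vec Bool k → ℚ) → ℚ
sumSubsets []          A = A []
sumSubsets (true  ∷ β) A = sumSubsets β (A ∘ (true ∷_)) + sumSubsets β (A ∘ (false ∷_))
sumSubsets (false ∷ β) A = sumSubsets β (A ∘ (false ∷_))

sumSubsets-cong : ∀ {k} (β : Vec Bool k) {A B : Vec Bool k → ℚ} → (∀ X → A X ≡ B X) → sumSubsets β A ≡ sumSubsets β B
sumSubsets-cong []          A≗B = A≗B []
sumSubsets-cong (true  ∷ β) A≗B = cong₂ _+_ (sumSubsets-cong β (A≗B ∘ (true ∷_))) (sumSubsets-cong β (A≗B ∘ (false ∷_)))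
sumSubsets-cong (false ∷ β) A≗B = sumSubsets-cong β (A≗B ∘ (false ∷_))

sumSubsets-zero : ∀ {k} (β : Vec Bool k) {A : Vec Bool k → ℚ} → (∀ X → A X ≡ 0ℚ) → sumSubsets β A ≡ 0ℚ
sumSubsets-zero []          A≗0 = A≗0 []
sumSubsets-zero (true  ∷ β) A≗0 = cong₂ _+_ (sumSubsets-zero β (A≗0 ∘ (true ∷_))) (sumSubsets-zero β (A≗0 ∘ (false ∷_)))
sumSubsets-zero (false ∷ β) A≗0 = sumSubsets-zero β (A≗0 ∘ (false ∷_))

sumSubsets-+ : ∀ {k} (β : Vec Bool k) (A B : Vec Bool k → ℚ) →
               sumSubsets β (λ X → A X + B X) ≡ sumSubsets β A + sumSubsets β B
sumSubsets-+ []          A B = refl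
sumSubsets-+ (true  ∷ β) A B =
  trans (cong₂ _+_ (sumSubsets-+ β (A ∘ (true ∷_)) (B ∘ (true ∷_))) (sumSubsets-+ β (A ∘ (false ∷_)) (B ∘ (false ∷_))))
        (ℚ+.interchange (sumSubsets β (A ∘ (true ∷_))) (sumSubsets β (B ∘ (true ∷_)))
                        (sumSubsets β (A ∘ (false ∷_))) (sumSubsets β (B ∘ (false ∷_))))
sumSubsets-+ (false ∷ β) A B = sumSubsets-+ β (A ∘ (false ∷_)) (B ∘ (false ∷_))

sumSubsets-*ˡ : ∀ {k} (β : Vec Bool k) (a : ℚ) (A : Vec Bool k → ℚ) → sumSubsets β (λ X → a * A X) ≡ a * sumSubsets β A
sumSubsets-*ˡ []          a A = refl
sumSubsets-*ˡ (true  ∷ β) a A = trans (cong₂ _+_ (sumSubsets-*ˡ β a (A ∘ (true ∷_))) (sumSubsets-*ˡ β a (A ∘ (false ∷_))))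
                                      (sym (ℚ.*-distribˡ-+ a _ _))
sumSubsets-*ˡ (false ∷ β) a A = sumSubsets-*ˡ β a (A ∘ (false ∷_))

OnLayer : ∀ {k} → ℕ → (Vec Bool k → ℚ) → Set
OnLayer c A = ∀ X → countOnes X ≢ c → A X ≡ 0ℚ

module _ {k : ℕ} {A : Vec Bool (suc k) → ℚ} where

  OnLayer-true : ∀ {c} → OnLayer (suc c) A → OnLayer c (A ∘ (true ∷_))
  OnLayer-true onA X |X|≢c = onA (true ∷ X) (|X|≢c ∘ ℕ.suc-injective)

  OnLayer-false : ∀ {c} → OnLayer c A → OnLayer c (A ∘ (false ∷_))
  OnLayer-false onA X = onA (false ∷ X)

  OnLayer-0-true : OnLayer 0 A → ∀ X → A (true ∷ X) ≡ 0ℚ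
  OnLayer-0-true onA X = onA (true ∷ X) (λ ())

sumSubsets-below-layer : ∀ {k c} (β : Vec Bool k) {A} → OnLayer c A → countOnes β < c → sumSubsets β A ≡ 0ℚ
sumSubsets-below-layer                 []          onA |β|<c = onA [] (λ c≡0 → ℕ.<-irrefl c≡0 |β|<c)
sumSubsets-below-layer {c = suc c} (true ∷ β) onA (s≤s |β|<c) =
  trans (cong₂ _+_ (sumSubsets-below-layer β (OnLayer-true onA) |β|<c)
                   (sumSubsets-below-layer β (OnLayer-false onA) (ℕ.m≤n⇒m≤1+n |β|<c)))
        (ℚ.+-identityʳ 0ℚ)
sumSubsets-below-layer                 (false ∷ β) onA |β|<c = sumSubsets-below-layer β (OnLayer-false onA) |β|<c

sumSubsets-on-layer : ∀ {k c} (β : Vec Bool k) {A} → OnLayer c A → countOnes β ≡ c → sumSubsets β A ≡ A β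
sumSubsets-on-layer []                      onA _     = refl
sumSubsets-on-layer {c = suc c} (true ∷ β) {A} onA |β|≡c = begin
  sumSubsets β (A ∘ (true ∷_)) + sumSubsets β (A ∘ (false ∷_))
    ≡⟨ cong₂ _+_ (sumSubsets-on-layer β (OnLayer-true onA) (ℕ.suc-injective |β|≡c))
                 (sumSubsets-below-layer β (OnLayer-false onA) (ℕ.≤-reflexive |β|≡c)) ⟩
  A (true ∷ β) + 0ℚ
    ≡⟨ ℚ.+-identityʳ _ ⟩
  A (true ∷ β) ∎
  where open ≡-Reasoning
sumSubsets-on-layer             (false ∷ β) onA |β|≡c = sumSubsets-on-layer β (OnLayer-false onA) |β|≡c

-- raise A X = ∑_{i ∈ X} A (X ∖ {i})
raise : ∀ {k} → (Vec Bool k → ℚ) → Vec Bool k → ℚ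
raise A []          = 0ℚ
raise A (true  ∷ X) = A (false ∷ X) + raise (A ∘ (true ∷_)) X
raise A (false ∷ X) = raise (A ∘ (false ∷_)) X

raise-zero : ∀ {k} {A : Vec Bool k → ℚ} → (∀ X → A X ≡ 0ℚ) → ∀ X → raise A X ≡ 0ℚ
raise-zero A≗0 []          = refl
raise-zero A≗0 (true  ∷ X) = trans (cong₂ _+_ (A≗0 (false ∷ X)) (raise-zero (A≗0 ∘ (true ∷_)) X)) (ℚ.+-identityʳ 0ℚ)
raise-zero A≗0 (false ∷ X) = raise-zero (A≗0 ∘ (false ∷_)) X

OnLayer-raise : ∀ {k c} {A : Vec Bool k → ℚ} → OnLayer c A → OnLayer (suc c) (raise A)
OnLayer-raise             onA []          _     = refl
OnLayer-raise {c = zero}  onA (true  ∷ X) |X|≢c =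
  trans (cong₂ _+_ (onA (false ∷ X) (|X|≢c ∘ cong suc)) (raise-zero (OnLayer-0-true onA) X)) (ℚ.+-identityʳ 0ℚ)
OnLayer-raise {c = suc c} onA (true  ∷ X) |X|≢c =
  trans (cong₂ _+_ (onA (false ∷ X) (|X|≢c ∘ cong suc)) (OnLayer-raise (OnLayer-true onA) X (|X|≢c ∘ cong suc)))
        (ℚ.+-identityʳ 0ℚ)
OnLayer-raise             onA (false ∷ X) |X|≢c = OnLayer-raise (OnLayer-false onA) X |X|≢c

sumSubsets-raise : ∀ {k} (β : Vec Bool k) (A : Vec Bool k → ℚ) →
  sumSubsets β (raise A) ≡ sumSubsets β (λ X → (fromℕ (countOnes β) - fromℕ (countOnes X)) * A X)
sumSubsets-raise []          A = sym (ℚ.*-zeroˡ (A []))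
sumSubsets-raise (true  ∷ β) A = begin
  sumSubsets β (λ X → A₀ X + raise A₁ X) + sumSubsets β (raise A₀)
    ≡⟨ cong (_+ sumSubsets β (raise A₀)) (sumSubsets-+ β A₀ (raise A₁)) ⟩
  (sumSubsets β A₀ + sumSubsets β (raise A₁)) + sumSubsets β (raise A₀)
    ≡⟨ cong₂ (λ x y → (sumSubsets β A₀ + x) + y) (sumSubsets-raise β A₁) (sumSubsets-raise β A₀) ⟩
  (sumSubsets β A₀ + sumSubsets β (λ X → w X * A₁ X)) + sumSubsets β (λ X → w X * A₀ X)
    ≡⟨ ℚ+.xy∙z≈y∙xz (sumSubsets β A₀) (sumSubsets β (λ X → w X * A₁ X)) (sumSubsets β (λ X → w X * A₀ X)) ⟩
  sumSubsets β (λ X → w X * A₁ X) + (sumSubsets β A₀ + sumSubsets β (λ X → w X * A₀ X))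
    ≡⟨ cong₂ _+_ (sumSubsets-cong β (λ X → cong (_* A₁ X) (sym (w-true X))))
                 (trans (sym (sumSubsets-+ β A₀ (λ X → w X * A₀ X))) (sumSubsets-cong β w-false)) ⟩
  sumSubsets β (λ X → w′ (true ∷ X) * A₁ X) + sumSubsets β (λ X → w′ (false ∷ X) * A₀ X)
    ∎
  where
  open ≡-Reasoning
  A₁ = A ∘ (true ∷_)
  A₀ = A ∘ (false ∷_)
  b = fromℕ (countOnes β)
  w : Vec Bool _ → ℚ
  w X = b - fromℕ (countOnes X)
  w′ : Vec Bool (suc _) → ℚ
  w′ X = fromℕ (countOnes (true ∷ β)) - fromℕ (countOnes X)
  w-true : ∀ X → w′ (true ∷ X) ≡ w X
  w-true X = trans (cong₂ _-_ (fromℕ-+ 1 (countOnes β)) (fromℕ-+ 1 (countOnes X))) ([1+x]-[1+y]≡x-y b _)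
    where
    [1+x]-[1+y]≡x-y : ∀ x y → (1ℚ + x) - (1ℚ + y) ≡ x - y
    [1+x]-[1+y]≡x-y = solve-∀ ℚ-ring
  w-false : ∀ X → A₀ X + w X * A₀ X ≡ w′ (false ∷ X) * A₀ X
  w-false X = trans (y+[x-z]*y≡[[1+x]-z]*y (A₀ X) b (fromℕ (countOnes X)))
                    (cong (λ x → (x - fromℕ (countOnes X)) * A₀ X) (sym (fromℕ-+ 1 (countOnes β))))
    where
    y+[x-z]*y≡[[1+x]-z]*y : ∀ y x z → y + (x - z) * y ≡ ((1ℚ + x) - z) * y
    y+[x-z]*y≡[[1+x]-z]*y = solve-∀ ℚ-ring
sumSubsets-raise (false ∷ β) A = sumSubsets-raise β (A ∘ (false ∷_))

sumSubsets-raise-layer : ∀ {k c} (β : Vec Bool k) {A : Vec Bool k → ℚ} → OnLayer c A →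
  sumSubsets β (raise A) ≡ (fromℕ (countOnes β) - fromℕ c) * sumSubsets β A
sumSubsets-raise-layer {c = c} β {A} onA =
  trans (sumSubsets-raise β A) (trans (sumSubsets-cong β weight) (sumSubsets-*ˡ β w A))
  where
  w = fromℕ (countOnes β) - fromℕ c
  weight : ∀ X → (fromℕ (countOnes β) - fromℕ (countOnes X)) * A X ≡ w * A X
  weight X with countOnes X ℕ.≟ c
  ... | yes |X|≡c = cong (λ x → (fromℕ (countOnes β) - fromℕ x) * A X) |X|≡c
  ... | no  |X|≢c rewrite onA X |X|≢c = trans (ℚ.*-zeroʳ (fromℕ (countOnes β) - fromℕ (countOnes X))) (sym (ℚ.*-zeroʳ w))

SubsetSumsVanish : ∀ {k} → ℕ → (Vec Bool k → ℚ) → Set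
SubsetSumsVanish j A = ∀ β → countOnes β ≡ j → sumSubsets β A ≡ 0ℚ

SubsetSumsInjective : ℕ → ℕ → ℕ → Set
SubsetSumsInjective N c j = (A : Vec Bool N → ℚ) → OnLayer c A → SubsetSumsVanish j A → ∀ X → A X ≡ 0ℚ

layer-diagonal : ∀ {N} j → SubsetSumsInjective N j j
layer-diagonal j A onA vanA X with countOnes X ℕ.≟ j
... | yes |X|≡j = trans (sym (sumSubsets-on-layer X onA |X|≡j)) (vanA X |X|≡j)
... | no  |X|≢j = onA X |X|≢j

vanish-by-head : ∀ {N} {A : Vec Bool (suc N) → ℚ} →
                 (∀ X → A (true ∷ X) ≡ 0ℚ) → (∀ X → A (false ∷ X) ≡ 0ℚ) → ∀ X → A X ≡ 0ℚ
vanish-by-head A₁≗0 A₀≗0 (true  ∷ X) = A₁≗0 X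
vanish-by-head A₁≗0 A₀≗0 (false ∷ X) = A₀≗0 X

injective-bottom : ∀ {N} j → SubsetSumsInjective N 0 j → SubsetSumsInjective (suc N) 0 (suc j)
injective-bottom j ih A onA vanA = vanish-by-head A₁≗0 (ih A₀ (OnLayer-false onA) vanA₀)
  where
  A₁ = A ∘ (true ∷_)
  A₀ = A ∘ (false ∷_)
  A₁≗0 = OnLayer-0-true onA
  vanA₀ : SubsetSumsVanish j A₀
  vanA₀ β |β|≡j = begin
    sumSubsets β A₀                    ≡⟨ ℚ.+-identityˡ _ ⟨
    0ℚ + sumSubsets β A₀               ≡⟨ cong (_+ sumSubsets β A₀) (sumSubsets-zero β A₁≗0) ⟨
    sumSubsets β A₁ + sumSubsets β A₀  ≡⟨ vanA (true ∷ β) (cong suc |β|≡j) ⟩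
    0ℚ                                 ∎
    where open ≡-Reasoning

-- With w = j − c, the function w·A₀ + raise A₁ on the smaller cube has vanishing j-sums, so it is
-- zero; then raise A₁ = −w·A₀, and the vanishing (j+1)-sums of A₀ become vanishing (j+1)-sums of A₁.
injective-raise : ∀ {N} c j → c < j → SubsetSumsInjective N (suc c) j → SubsetSumsInjective N c (suc j) →
                  SubsetSumsInjective (suc N) (suc c) (suc j)
injective-raise {N} c j c<j ih₁ ih₂ A onA vanA = vanish-by-head A₁≗0 A₀≗0
  where
  open ≡-Reasoning
  A₁ A₀ : Vec Bool N → ℚ
  A₁ = A ∘ (true ∷_)
  A₀ = A ∘ (false ∷_)
  onA₁ : OnLayer c A₁
  onA₁ = OnLayer-true onA
  w : ℚ
  w = fromℕ (j ℕ.∸ c)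
  instance
    w≢0 : ℚ.NonZero w
    w≢0 = fromℕ-nonZero (j ℕ.∸ c) {{ℕ.>-nonZero (ℕ.m<n⇒0<n∸m c<j)}}
  A′ : Vec Bool N → ℚ
  A′ X = w * A₀ X + raise A₁ X
  onA′ : OnLayer (suc c) A′
  onA′ X |X|≢1+c = begin
    w * A₀ X + raise A₁ X ≡⟨ cong₂ _+_ (cong (w *_) (OnLayer-false onA X |X|≢1+c)) (OnLayer-raise onA₁ X |X|≢1+c) ⟩
    w * 0ℚ + 0ℚ           ≡⟨ trans (ℚ.+-identityʳ _) (ℚ.*-zeroʳ w) ⟩
    0ℚ                    ∎
  vanA′ : SubsetSumsVanish j A′
  vanA′ β |β|≡j = begin
    sumSubsets β A′
      ≡⟨ sumSubsets-+ β (λ X → w * A₀ X) (raise A₁) ⟩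
    sumSubsets β (λ X → w * A₀ X) + sumSubsets β (raise A₁)
      ≡⟨ cong₂ _+_ (sumSubsets-*ˡ β w A₀) (sumSubsets-raise-layer β onA₁) ⟩
    w * sumSubsets β A₀ + (fromℕ (countOnes β) - fromℕ c) * sumSubsets β A₁
      ≡⟨ cong (λ x → w * sumSubsets β A₀ + x * sumSubsets β A₁) w≡ ⟩
    w * sumSubsets β A₀ + w * sumSubsets β A₁
      ≡⟨ ℚ.+-comm (w * sumSubsets β A₀) _ ⟩
    w * sumSubsets β A₁ + w * sumSubsets β A₀
      ≡⟨ ℚ.*-distribˡ-+ w _ _ ⟨
    w * (sumSubsets β A₁ + sumSubsets β A₀)
      ≡⟨ cong (w *_) (vanA (true ∷ β) (cong suc |β|≡j)) ⟩
    w * 0ℚ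
      ≡⟨ ℚ.*-zeroʳ w ⟩
    0ℚ ∎
    where
    w≡ : fromℕ (countOnes β) - fromℕ c ≡ w
    w≡ = trans (cong (λ x → fromℕ x - fromℕ c) |β|≡j) (sym (fromℕ-∸ (ℕ.<⇒≤ c<j)))
  A′≗0 : ∀ X → A′ X ≡ 0ℚ
  A′≗0 = ih₁ A′ onA′ vanA′
  raise≗ : ∀ X → raise A₁ X ≡ (- w) * A₀ X
  raise≗ X = begin
    raise A₁ X                       ≡⟨ y≡[x*a+y]+-x*a w (A₀ X) (raise A₁ X) ⟩
    A′ X + (- w) * A₀ X              ≡⟨ cong (_+ (- w) * A₀ X) (A′≗0 X) ⟩
    0ℚ + (- w) * A₀ X                ≡⟨ ℚ.+-identityˡ _ ⟩
    (- w) * A₀ X                     ∎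
    where
    y≡[x*a+y]+-x*a : ∀ x a y → y ≡ (x * a + y) + (- x) * a
    y≡[x*a+y]+-x*a = solve-∀ ℚ-ring
  vanA₁ : SubsetSumsVanish (suc j) A₁
  vanA₁ β |β|≡1+j = *-cancelˡ-≡0 v (sumSubsets β A₁) {{v≢0}} (begin
    v * sumSubsets β A₁                              ≡⟨ cong (_* sumSubsets β A₁) v≡ ⟨
    (fromℕ (countOnes β) - fromℕ c) * sumSubsets β A₁ ≡⟨ sumSubsets-raise-layer β onA₁ ⟨
    sumSubsets β (raise A₁)                          ≡⟨ sumSubsets-cong β raise≗ ⟩
    sumSubsets β (λ X → (- w) * A₀ X)                ≡⟨ sumSubsets-*ˡ β (- w) A₀ ⟩
    (- w) * sumSubsets β A₀                          ≡⟨ cong ((- w) *_) (vanA (false ∷ β) |β|≡1+j) ⟩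
    (- w) * 0ℚ                                       ≡⟨ ℚ.*-zeroʳ (- w) ⟩
    0ℚ                                               ∎)
    where
    c<1+j = ℕ.m≤n⇒m≤1+n c<j
    v = fromℕ (suc j ℕ.∸ c)
    v≢0 = fromℕ-nonZero (suc j ℕ.∸ c) {{ℕ.>-nonZero (ℕ.m<n⇒0<n∸m c<1+j)}}
    v≡ : fromℕ (countOnes β) - fromℕ c ≡ v
    v≡ = trans (cong (λ x → fromℕ x - fromℕ c) |β|≡1+j) (sym (fromℕ-∸ (ℕ.<⇒≤ c<1+j)))
  A₁≗0 : ∀ X → A₁ X ≡ 0ℚ
  A₁≗0 = ih₂ A₁ onA₁ vanA₁
  A₀≗0 : ∀ X → A₀ X ≡ 0ℚ
  A₀≗0 X = *-cancelˡ-≡0 w (A₀ X) (begin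
    w * A₀ X                ≡⟨ ℚ.+-identityʳ _ ⟨
    w * A₀ X + 0ℚ           ≡⟨ cong (w * A₀ X +_) (raise-zero A₁≗0 X) ⟨
    A′ X                    ≡⟨ A′≗0 X ⟩
    0ℚ                      ∎)

subsetSums-injective : ∀ N c j → c ≤ j → c ℕ.+ j ≤ N → SubsetSumsInjective N c j
subsetSums-injective N       zero    zero    _   _       = layer-diagonal 0
subsetSums-injective zero    zero    (suc j) _   ()
subsetSums-injective zero    (suc c) j       _   ()
subsetSums-injective (suc N) (suc c) zero    ()  _
subsetSums-injective (suc N) zero    (suc j) _   c+j≤1+N =
  injective-bottom j (subsetSums-injective N 0 j z≤n (ℕ.≤-pred c+j≤1+N))
subsetSums-injective (suc N) (suc c) (suc j) c≤j c+j≤1+N with c ℕ.≟ j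
... | yes refl = layer-diagonal (suc j)
... | no  c≢j  =
  injective-raise c j c<j (subsetSums-injective N (suc c) j c<j (subst (_≤ N) (ℕ.+-suc c j) c+1+j≤N))
                          (subsetSums-injective N c (suc j) (ℕ.m≤n⇒m≤1+n (ℕ.<⇒≤ c<j)) c+1+j≤N)
  where
  c<j = ℕ.≤∧≢⇒< (ℕ.≤-pred c≤j) c≢j
  c+1+j≤N = ℕ.≤-pred c+j≤1+N

-- Multilinearization and homogenization

squarefree : ∀ {k} → Vec Bool k → Mon k
squarefree = Vec.map (λ b → if b then 1 else 0)

support : ∀ {k} → Mon k → Vec Bool k
support = Vec.map (λ { zero → false ; (suc _) → true })

insert : ∀ {k} → Vec Bool k → Fin k → Vec Bool k
insert T i = Vec.updateAt T i (λ _ → true)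

totalDeg-squarefree : ∀ {k} (T : Vec Bool k) → totalDeg (squarefree T) ≡ countOnes T
totalDeg-squarefree []          = refl
totalDeg-squarefree (true  ∷ T) = cong suc (totalDeg-squarefree T)
totalDeg-squarefree (false ∷ T) = totalDeg-squarefree T

countOnes-support : ∀ {k} (m : Mon k) → countOnes (support m) ≤ totalDeg m
countOnes-support []          = z≤n
countOnes-support (zero  ∷ m) = countOnes-support m
countOnes-support (suc e ∷ m) = s≤s (ℕ.≤-trans (countOnes-support m) (ℕ.m≤n+m (totalDeg m) e))

support-squarefree : ∀ {k} (T : Vec Bool k) → support (squarefree T) ≡ T
support-squarefree []          = refl
support-squarefree (true  ∷ T) = cong (true ∷_) (support-squarefree T)
support-squarefree (false ∷ T) = cong (false ∷_) (support-squarefree T)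

support-·-var : ∀ {k} (r : Mon k) (i : Fin k) → support (r · varMon i) ≡ support (r · sqMon i)
support-·-var (e ∷ r) Fin.zero    rewrite ℕ.+-comm e 1 | ℕ.+-comm e 2 = refl
support-·-var (e ∷ r) (Fin.suc i) = cong (_ ∷_) (support-·-var r i)

support-squarefree-·-zeroMon : ∀ {k} (T : Vec Bool k) → support (squarefree T · zeroMon k) ≡ T
support-squarefree-·-zeroMon T = trans (cong support (·-identityʳ (squarefree T))) (support-squarefree T)

support-squarefree-·-var : ∀ {k} (T : Vec Bool k) (i : Fin k) → support (squarefree T · varMon i) ≡ insert T i
support-squarefree-·-var (true  ∷ T) Fin.zero    = cong (true ∷_) (support-squarefree-·-zeroMon T)
support-squarefree-·-var (false ∷ T) Fin.zero    = cong (true ∷_) (support-squarefree-·-zeroMon T)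
support-squarefree-·-var (true  ∷ T) (Fin.suc i) = cong (true ∷_) (support-squarefree-·-var T i)
support-squarefree-·-var (false ∷ T) (Fin.suc i) = cong (false ∷_) (support-squarefree-·-var T i)

countOnes-insert : ∀ {k} (T : Vec Bool k) (i : Fin k) → Vec.lookup T i ≡ false → countOnes (insert T i) ≡ suc (countOnes T)
countOnes-insert (false ∷ T) Fin.zero    _    = refl
countOnes-insert (true  ∷ T) (Fin.suc i) Tᵢ≡f = cong suc (countOnes-insert T i Tᵢ≡f)
countOnes-insert (false ∷ T) (Fin.suc i) Tᵢ≡f = countOnes-insert T i Tᵢ≡f

insert-member : ∀ {k} (T : Vec Bool k) (i : Fin k) → Vec.lookup T i ≡ true → insert T i ≡ T
insert-member (true ∷ T) Fin.zero    _    = refl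
insert-member (b    ∷ T) (Fin.suc i) Tᵢ≡t = cong (b ∷_) (insert-member T i Tᵢ≡t)

square-factor-or-squarefree : ∀ {k} (m : Mon k) →
  (Σ[ r ∈ Mon k ] Σ[ i ∈ Fin k ] m ≡ r · sqMon i) ⊎ (m ≡ squarefree (support m))
square-factor-or-squarefree []                = inj₂ refl
square-factor-or-squarefree (suc (suc e) ∷ m) =
  inj₁ (e ∷ m , Fin.zero , cong₂ _∷_ (ℕ.+-comm 2 e) (sym (·-identityʳ m)))
square-factor-or-squarefree (zero ∷ m) with square-factor-or-squarefree m
... | inj₁ (r , i , m≡r·xᵢ²) = inj₁ (0 ∷ r , Fin.suc i , cong (0 ∷_) m≡r·xᵢ²)
... | inj₂ m≡xˢ             = inj₂ (cong (0 ∷_) m≡xˢ)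
square-factor-or-squarefree (suc zero ∷ m) with square-factor-or-squarefree m
... | inj₁ (r , i , m≡r·xᵢ²) = inj₁ (1 ∷ r , Fin.suc i , cong (1 ∷_) m≡r·xᵢ²)
... | inj₂ m≡xˢ             = inj₂ (cong (1 ∷_) m≡xˢ)

module Multilinearization (n d : ℕ) where

  open Modulo n d
  open ∼-Reasoning

  multilinearize : ∀ m → totalDeg m ≤ d → δ m ∼ δ (squarefree (support m))
  multilinearize m = go m (<-wellFounded (totalDeg m))
    where
    go : ∀ m → Acc _<_ (totalDeg m) → totalDeg m ≤ d → δ m ∼ δ (squarefree (support m))
    go m (acc smaller) m≤d with square-factor-or-squarefree m
    ... | inj₂ m≡xˢ = ≗⇒∼ (λ x → cong (λ y → δ y x) m≡xˢ)
    ... | inj₁ (r , i , refl) = begin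
      δ (r · sqMon i)                           ≈⟨ square-step r i (subst (_≤ d) (totalDeg-·-power r i 2) m≤d) ⟩
      δ (r · varMon i)                          ≈⟨ go (r · varMon i) (smaller lower) (ℕ.≤-trans (ℕ.<⇒≤ lower) m≤d) ⟩
      δ (squarefree (support (r · varMon i)))   ≡⟨ cong (δ ∘ squarefree) (support-·-var r i) ⟩
      δ (squarefree (support (r · sqMon i)))    ∎
      where
      lower : totalDeg (r · varMon i) < totalDeg (r · sqMon i)
      lower = subst₂ _<_ (sym (totalDeg-·-power r i 1)) (sym (totalDeg-·-power r i 2))
                     (ℕ.+-monoʳ-< (totalDeg r) (ℕ.n<1+n 1))

∑-allBool-suc : ∀ {k} (F : Vec Bool (suc k) → ℚ) →
                ∑ (allBool (suc k)) F ≡ ∑ (allBool k) (F ∘ (true ∷_)) + ∑ (allBool k) (F ∘ (false ∷_))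
∑-allBool-suc {k} F = begin
  ∑ (allBool (suc k)) F
    ≡⟨ ∑-concatMap (λ b → map (b ∷_) (allBool k)) (true ∷ false ∷ []) F ⟩
  ∑ (map (true ∷_) (allBool k)) F + (∑ (map (false ∷_) (allBool k)) F + 0ℚ)
    ≡⟨ cong (∑ (map (true ∷_) (allBool k)) F +_) (ℚ.+-identityʳ _) ⟩
  ∑ (map (true ∷_) (allBool k)) F + ∑ (map (false ∷_) (allBool k)) F
    ≡⟨ cong₂ _+_ (∑-map (true ∷_) (allBool k) F) (∑-map (false ∷_) (allBool k) F) ⟩
  ∑ (allBool k) (F ∘ (true ∷_)) + ∑ (allBool k) (F ∘ (false ∷_)) ∎
  where open ≡-Reasoning

allBool-complete : ∀ {k} (α : Vec Bool k) → α ∈ allBool k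
allBool-complete []          = here refl
allBool-complete (true  ∷ α) = ∈-++⁺ˡ (∈-map⁺ (true ∷_) (allBool-complete α))
allBool-complete (false ∷ α) = ∈-++⁺ʳ (map (true ∷_) (allBool _)) (∈-++⁺ˡ (∈-map⁺ (false ∷_) (allBool-complete α)))

∈-S : ∀ {n} {α : Vec Bool (2 ℕ.* n)} → countOnes α ≡ n → α ∈ S n
∈-S {n} |α|≡n = ∈-filter⁺ (λ β → countOnes β ℕ.≟ n) (allBool-complete _) |α|≡n

multilinear : ∀ {k} → (Vec Bool k → ℚ) → Poly k
multilinear {k} a = map (λ X → (a X , squarefree X)) (allBool k)

coeff-multilinear : ∀ {k} (a : Vec Bool k → ℚ) m → coeff (multilinear a) m ≡ ∑[ X ∈ allBool k ] (a X * δ (squarefree X) m)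
coeff-multilinear {k} a m = trans (coeff-⟪⟫ (multilinear a) m) (∑-map _ (allBool k) _)

coeff-multilinear-⨁ : ∀ {A : Set} {k} (xs : List A) (a : A → Vec Bool k → ℚ) →
  coeff (multilinear (λ X → ∑[ x ∈ xs ] a x X)) ≗ ⨁[ x ∈ xs ] coeff (multilinear (a x))
coeff-multilinear-⨁ {k = k} xs a m = begin
  coeff (multilinear (λ X → ∑[ x ∈ xs ] a x X)) m
    ≡⟨ coeff-multilinear _ m ⟩
  ∑[ X ∈ allBool k ] ((∑[ x ∈ xs ] a x X) * δ (squarefree X) m)
    ≡⟨ ∑-cong (allBool k) (λ X → *-distribʳ-∑ _ xs (λ x → a x X)) ⟩
  ∑[ X ∈ allBool k ] ∑[ x ∈ xs ] (a x X * δ (squarefree X) m)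
    ≡⟨ ∑-comm (allBool k) xs _ ⟩
  ∑[ x ∈ xs ] ∑[ X ∈ allBool k ] (a x X * δ (squarefree X) m)
    ≡⟨ ∑-cong xs (λ x → coeff-multilinear (a x) m) ⟨
  ∑[ x ∈ xs ] coeff (multilinear (a x)) m ∎
  where open ≡-Reasoning

coeff-multilinear-⊛ : ∀ {k} (c : ℚ) (a : Vec Bool k → ℚ) → coeff (multilinear (λ X → c * a X)) ≗ c ⊛ coeff (multilinear a)
coeff-multilinear-⊛ {k} c a m = begin
  coeff (multilinear (λ X → c * a X)) m                ≡⟨ coeff-multilinear _ m ⟩
  ∑[ X ∈ allBool k ] ((c * a X) * δ (squarefree X) m)  ≡⟨ ∑-cong (allBool k) (λ X → ℚ.*-assoc c (a X) _) ⟩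
  ∑[ X ∈ allBool k ] (c * (a X * δ (squarefree X) m))  ≡⟨ *-distribˡ-∑ c (allBool k) _ ⟨
  c * ∑[ X ∈ allBool k ] (a X * δ (squarefree X) m)    ≡⟨ cong (c *_) (coeff-multilinear a m) ⟨
  c * coeff (multilinear a) m                          ∎
  where open ≡-Reasoning

𝟙 : ∀ {k} → Vec Bool k → Vec Bool k → ℚ
𝟙 []          []          = 1ℚ
𝟙 (true  ∷ T) (true  ∷ X) = 𝟙 T X
𝟙 (false ∷ T) (false ∷ X) = 𝟙 T X
𝟙 (true  ∷ T) (false ∷ X) = 0ℚ
𝟙 (false ∷ T) (true  ∷ X) = 0ℚ

∑-allBool-𝟙 : ∀ {k} (T : Vec Bool k) (F : Vec Bool k → ℚ) → ∑[ X ∈ allBool k ] (𝟙 T X * F X) ≡ F T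
∑-allBool-𝟙 []          F = trans (ℚ.+-identityʳ _) (ℚ.*-identityˡ (F []))
∑-allBool-𝟙 (true  ∷ T) F = trans (∑-allBool-suc (λ X → 𝟙 (true ∷ T) X * F X))
  (trans (cong₂ _+_ (∑-allBool-𝟙 T (F ∘ (true ∷_))) (∑-zero (allBool _) (λ X → ℚ.*-zeroˡ (F (false ∷ X)))))
         (ℚ.+-identityʳ _))
∑-allBool-𝟙 (false ∷ T) F = trans (∑-allBool-suc (λ X → 𝟙 (false ∷ T) X * F X))
  (trans (cong₂ _+_ (∑-zero (allBool _) (λ X → ℚ.*-zeroˡ (F (true ∷ X)))) (∑-allBool-𝟙 T (F ∘ (false ∷_))))
         (ℚ.+-identityˡ _))

OnLayer-𝟙 : ∀ {k} (T : Vec Bool k) → OnLayer (countOnes T) (𝟙 T)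
OnLayer-𝟙 []          []          |X|≢|T| = ⊥-elim (|X|≢|T| refl)
OnLayer-𝟙 (true  ∷ T) (true  ∷ X) |X|≢|T| = OnLayer-𝟙 T X (|X|≢|T| ∘ cong suc)
OnLayer-𝟙 (false ∷ T) (false ∷ X) |X|≢|T| = OnLayer-𝟙 T X |X|≢|T|
OnLayer-𝟙 (true  ∷ T) (false ∷ X) _       = refl
OnLayer-𝟙 (false ∷ T) (true  ∷ X) _       = refl

coeff-multilinear-𝟙 : ∀ {k} (T : Vec Bool k) → coeff (multilinear (𝟙 T)) ≗ δ (squarefree T)
coeff-multilinear-𝟙 T m = trans (coeff-multilinear (𝟙 T) m) (∑-allBool-𝟙 T (λ X → δ (squarefree X) m))

eval-multilinear : ∀ {k} (a : Vec Bool k → ℚ) (α : Vec Bool k) → eval (multilinear a) α ≡ sumSubsets α a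
eval-multilinear {k} a α = trans (∑-map _ (allBool k) _) (subsets a α)
  where
  subsets : ∀ {k} (a : Vec Bool k → ℚ) α → ∑[ X ∈ allBool k ] (a X * evalMon (squarefree X) α) ≡ sumSubsets α a
  subsets a []          = trans (ℚ.+-identityʳ _) (ℚ.*-identityʳ (a []))
  subsets a (true  ∷ α) = trans (∑-allBool-suc (λ X → a X * evalMon (squarefree X) (true ∷ α)))
    (cong₂ _+_ (trans (∑-cong (allBool _) (λ X → cong (a (true ∷ X) *_) (ℚ.*-identityˡ _))) (subsets (a ∘ (true ∷_)) α))
               (trans (∑-cong (allBool _) (λ X → cong (a (false ∷ X) *_) (ℚ.*-identityˡ _))) (subsets (a ∘ (false ∷_)) α)))
  subsets a (false ∷ α) = trans (∑-allBool-suc (λ X → a X * evalMon (squarefree X) (false ∷ α)))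
    (trans (cong₂ _+_ (∑-zero (allBool _) (λ X → trans (cong (a (true ∷ X) *_) (ℚ.*-zeroˡ (evalMon (squarefree X) α)))
                                                      (ℚ.*-zeroʳ (a (true ∷ X)))))
                      (trans (∑-cong (allBool _) (λ X → cong (a (false ∷ X) *_) (ℚ.*-identityˡ _))) (subsets (a ∘ (false ∷_)) α)))
           (ℚ.+-identityˡ _))

δ-insert : ∀ {k} → Vec Bool k → Fin k → Coeffs k
δ-insert T i = if Vec.lookup T i then 𝟘 else δ (squarefree (insert T i))

∑-δ-insert : ∀ {k} (T : Vec Bool k) m →
  ∑[ i ∈ allFin k ] δ (squarefree (insert T i)) m ≡ ∑[ i ∈ allFin k ] δ-insert T i m + fromℕ (countOnes T) * δ (squarefree T) m
∑-δ-insert {k} T m = begin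
  ∑[ i ∈ allFin k ] δ (squarefree (insert T i)) m
    ≡⟨ ∑-cong (allFin k) split ⟩
  ∑[ i ∈ allFin k ] (δ-insert T i m + boolℚ (Vec.lookup T i) * δ x m)
    ≡⟨ ∑-distrib-+ (allFin k) (λ i → δ-insert T i m) _ ⟩
  ∑[ i ∈ allFin k ] δ-insert T i m + ∑[ i ∈ allFin k ] (boolℚ (Vec.lookup T i) * δ x m)
    ≡⟨ cong (∑[ i ∈ allFin k ] δ-insert T i m +_) count ⟩
  ∑[ i ∈ allFin k ] δ-insert T i m + fromℕ (countOnes T) * δ x m ∎
  where
  open ≡-Reasoning
  x = squarefree T
  split : ∀ i → δ (squarefree (insert T i)) m ≡ δ-insert T i m + boolℚ (Vec.lookup T i) * δ x m
  split i with Vec.lookup T i in Tᵢ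
  ... | true  = trans (cong (λ y → δ (squarefree y) m) (insert-member T i Tᵢ))
                      (sym (trans (ℚ.+-identityˡ _) (ℚ.*-identityˡ (δ x m))))
  ... | false = sym (trans (cong (δ (squarefree (insert T i)) m +_) (ℚ.*-zeroˡ (δ x m))) (ℚ.+-identityʳ _))
  count : ∑[ i ∈ allFin k ] (boolℚ (Vec.lookup T i) * δ x m) ≡ fromℕ (countOnes T) * δ x m
  count = trans (sym (*-distribʳ-∑ (δ x m) (allFin k) _)) (cong (_* δ x m) (∑-boolℚ T))

monsUpTo-degree : ∀ k e → All (λ m → totalDeg m ≤ e) (monsUpTo k e)
monsUpTo-degree zero    e = z≤n ∷ []
monsUpTo-degree (suc k) e = All.concat⁺ (All.map⁺ (All.applyUpTo⁺₁ id (suc e) (λ {a} a<1+e →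
  All.map⁺ (All.map (λ {m} m≤e∸a → bound a m a<1+e m≤e∸a) (monsUpTo-degree k (e ℕ.∸ a))))))
  where
  bound : ∀ a (m : Mon k) → a < suc e → totalDeg m ≤ e ℕ.∸ a → a ℕ.+ totalDeg m ≤ e
  bound a m a<1+e m≤e∸a = ℕ.≤-trans (ℕ.+-monoʳ-≤ a m≤e∸a) (ℕ.≤-reflexive (ℕ.m+[n∸m]≡n (ℕ.≤-pred a<1+e)))

𝐯-degree : ∀ n d (j : Idx n d) → totalDeg (𝐯 n d j) ≤ d
𝐯-degree n d j = All.lookup (monsUpTo-degree (2 ℕ.* n) d) (∈-lookup j)

module Homogenization (n d : ℕ) where

  open Modulo n d
  open Multilinearization n d

  Homogenizable : Coeffs (2 ℕ.* n) → Set
  Homogenizable F = Σ[ a ∈ (Vec Bool (2 ℕ.* n) → ℚ) ] (OnLayer d a × F ∼ coeff (multilinear a))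

  homogenizable-resp : ∀ {F G} → F ∼ G → Homogenizable G → Homogenizable F
  homogenizable-resp F∼G (a , onA , G∼a) = a , onA , ∼-trans F∼G G∼a

  homogenizable-⊛ : ∀ c {F} → Homogenizable F → Homogenizable (c ⊛ F)
  homogenizable-⊛ c (a , onA , F∼a) =
    (λ X → c * a X) , (λ X |X|≢d → trans (cong (c *_) (onA X |X|≢d)) (ℚ.*-zeroʳ c)) ,
    ∼-trans (⊛-cong c F∼a) (≗⇒∼ (sym ∘ coeff-multilinear-⊛ c a))

  homogenizable-⨁ : ∀ {A : Set} (xs : List A) {F : A → Coeffs (2 ℕ.* n)} →
                    (∀ x → Homogenizable (F x)) → Homogenizable (⨁ xs F)
  homogenizable-⨁ xs hom =
    (λ X → ∑[ x ∈ xs ] a x X) , (λ X |X|≢d → ∑-zero xs (λ x → proj₁ (proj₂ (hom x)) X |X|≢d)) ,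
    ∼-trans (⨁-cong xs (proj₂ ∘ proj₂ ∘ hom)) (≗⇒∼ (sym ∘ coeff-multilinear-⨁ xs a))
    where
    a = proj₁ ∘ hom

  homogenizable-𝟘 : Homogenizable 𝟘
  homogenizable-𝟘 = (λ _ → 0ℚ) , (λ _ _ → refl) , ≗⇒∼ (λ m →
    sym (trans (coeff-multilinear (λ _ → 0ℚ) m) (∑-zero (allBool _) (λ X → ℚ.*-zeroˡ (δ (squarefree X) m)))))

  module _ (d≤n : d ≤ n) where

    lift-step : ∀ T → countOnes T < d → fromℕ (n ℕ.∸ countOnes T) ⊛ δ (squarefree T) ∼ ⨁[ i ∈ allFin (2 ℕ.* n) ] δ-insert T i
    lift-step T t<d = begin
      fromℕ (n ℕ.∸ t) ⊛ δ x
        ≈⟨ ≗⇒∼ expand ⟩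
      fromℕ n ⊛ δ x ⊕ (- fromℕ t) ⊛ δ x
        ≈⟨ ⊕-cong (∼-sym (sum-step x deg)) ∼-refl ⟩
      ⨁[ i ∈ allFin _ ] δ (x · varMon i) ⊕ (- fromℕ t) ⊛ δ x
        ≈⟨ ⊕-cong (⨁-cong (allFin _) reduce) ∼-refl ⟩
      ⨁[ i ∈ allFin _ ] δ (squarefree (insert T i)) ⊕ (- fromℕ t) ⊛ δ x
        ≈⟨ ≗⇒∼ cancel ⟩
      ⨁[ i ∈ allFin _ ] δ-insert T i ∎
      where
      open ∼-Reasoning
      t = countOnes T
      x = squarefree T
      deg : totalDeg x ℕ.+ 1 ≤ d
      deg = subst (λ e → e ℕ.+ 1 ≤ d) (sym (totalDeg-squarefree T)) (subst (_≤ d) (ℕ.+-comm 1 t) t<d)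
      reduce : ∀ i → δ (x · varMon i) ∼ δ (squarefree (insert T i))
      reduce i = ∼-trans (multilinearize (x · varMon i) (subst (_≤ d) (sym (totalDeg-·-power x i 1)) deg))
                         (≗⇒∼ (λ m → cong (λ y → δ (squarefree y) m) (support-squarefree-·-var T i)))
      expand : ∀ m → fromℕ (n ℕ.∸ t) * δ x m ≡ fromℕ n * δ x m + (- fromℕ t) * δ x m
      expand m = trans (cong (_* δ x m) (fromℕ-∸ (ℕ.≤-trans (ℕ.<⇒≤ t<d) d≤n))) ([a-b]*c≡a*c+[-b]*c (fromℕ n) (fromℕ t) (δ x m))
        where
        [a-b]*c≡a*c+[-b]*c : ∀ a b c → (a - b) * c ≡ a * c + (- b) * c
        [a-b]*c≡a*c+[-b]*c = solve-∀ ℚ-ring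
      cancel : ∀ m → ∑[ i ∈ allFin _ ] δ (squarefree (insert T i)) m + (- fromℕ t) * δ x m ≡ ∑[ i ∈ allFin _ ] δ-insert T i m
      cancel m = trans (cong (_+ (- fromℕ t) * δ x m) (∑-δ-insert T m)) ([a+b*c]+[-b]*c≡a _ (fromℕ t) (δ x m))
        where
        [a+b*c]+[-b]*c≡a : ∀ a b c → (a + b * c) + (- b) * c ≡ a
        [a+b*c]+[-b]*c≡a = solve-∀ ℚ-ring

    squarefree-homogenizable : ∀ T → countOnes T ≤ d → Homogenizable (δ (squarefree T))
    squarefree-homogenizable T t≤d = lift (d ℕ.∸ countOnes T) T (ℕ.m+[n∸m]≡n t≤d)
      where
      lift : ∀ f T → countOnes T ℕ.+ f ≡ d → Homogenizable (δ (squarefree T))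
      lift zero    T t+0≡d =
        𝟙 T , subst (λ c → OnLayer c (𝟙 T)) (trans (sym (ℕ.+-identityʳ _)) t+0≡d) (OnLayer-𝟙 T) ,
        ≗⇒∼ (sym ∘ coeff-multilinear-𝟙 T)
      lift (suc f) T t+1+f≡d =
        homogenizable-resp (≗⇒∼ unscale)
          (homogenizable-⊛ (1/ w) (homogenizable-resp (lift-step T t<d) (homogenizable-⨁ (allFin _) extend)))
        where
        t = countOnes T
        t<d : t < d
        t<d = subst (t <_) t+1+f≡d (subst (_≤ t ℕ.+ suc f) (ℕ.+-comm t 1) (ℕ.+-monoʳ-≤ t (s≤s z≤n)))
        w = fromℕ (n ℕ.∸ t)
        instance
          w≢0 : ℚ.NonZero w
          w≢0 = fromℕ-nonZero (n ℕ.∸ t) {{ℕ.>-nonZero (ℕ.m<n⇒0<n∸m (ℕ.<-≤-trans t<d d≤n))}}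
        unscale : ∀ m → δ (squarefree T) m ≡ 1/ w * (w * δ (squarefree T) m)
        unscale m = sym (trans (sym (ℚ.*-assoc (1/ w) w _))
                               (trans (cong (_* δ (squarefree T) m) (ℚ.*-inverseˡ w)) (ℚ.*-identityˡ _)))
        extend : ∀ i → Homogenizable (δ-insert T i)
        extend i with Vec.lookup T i in Tᵢ
        ... | true  = homogenizable-𝟘
        ... | false = lift f (insert T i) (trans (cong (ℕ._+ f) (countOnes-insert T i Tᵢ)) (trans (sym (ℕ.+-suc t f)) t+1+f≡d))

    monomial-homogenizable : ∀ m → totalDeg m ≤ d → Homogenizable (δ m)
    monomial-homogenizable m m≤d =
      homogenizable-resp (multilinearize m m≤d) (squarefree-homogenizable (support m) (ℕ.≤-trans (countOnes-support m) m≤d))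

    cTv-homogenizable : (c : Idx n d → ℚ) → Homogenizable (coeff (cTv n d c))
    cTv-homogenizable c = homogenizable-resp (≗⇒∼ coeff-cTv)
      (homogenizable-⨁ (allFin _) (λ j → homogenizable-⊛ (c j) (monomial-homogenizable (𝐯 n d j) (𝐯-degree n d j))))
      where
      coeff-cTv : ∀ m → coeff (cTv n d c) m ≡ ∑[ j ∈ allFin _ ] (c j * δ (𝐯 n d j) m)
      coeff-cTv m = trans (coeff-⟪⟫ (cTv n d c) m) (∑-map (λ j → (c j , 𝐯 n d j)) (allFin _) (λ (a , x) → a * δ x m))

-- Moments

weight : ∀ {A : Set} → List A → ℚ
weight []       = 0ℚ
weight (x ∷ xs) = ℤ.+ 1 / suc (length xs)

avg-map : ∀ {A : Set} (xs : List A) (g : A → ℚ) → avg (map g xs) ≡ weight xs * ∑ xs g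
avg-map []       g = sym (ℚ.*-zeroˡ 0ℚ)
avg-map (x ∷ xs) g = trans (cong (λ l → ∑ (x ∷ xs) g * (ℤ.+ 1 / suc l)) (List.length-map g xs))
                           (ℚ.*-comm (∑ (x ∷ xs) g) (weight (x ∷ xs)))

avg-squares-≡0 : ∀ {A : Set} (xs : List A) (f : A → ℚ) → avg (map (λ x → f x * f x) xs) ≡ 0ℚ → ∀ {x} → x ∈ xs → f x ≡ 0ℚ
avg-squares-≡0 (y ∷ ys) f avg≡0 = ∑-squares-≡0 (y ∷ ys) f
  (*-cancelˡ-≡0 (weight (y ∷ ys)) _ {{w≢0}} (trans (sym (avg-map (y ∷ ys) (λ x → f x * f x))) avg≡0))
  where
  w≢0 = ℚ.pos⇒nonZero (weight (y ∷ ys)) {{ℚ.normalize-pos 1 (suc (length ys))}}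

∑-pairing : ∀ {A J : Set} (js : List J) (xs : List A) (c : J → ℚ) (e : J → A → ℚ) w (g : A → ℚ) →
  ∑[ j ∈ js ] (c j * (w * ∑[ α ∈ xs ] (e j α * g α))) ≡ w * ∑[ α ∈ xs ] (∑[ j ∈ js ] (c j * e j α) * g α)
∑-pairing js xs c e w g = begin
  ∑[ j ∈ js ] (c j * (w * ∑[ α ∈ xs ] (e j α * g α)))
    ≡⟨ ∑-cong js (λ j → trans (ℚ*.x∙yz≈y∙xz (c j) w _) (cong (w *_) (*-distribˡ-∑ (c j) xs _))) ⟩
  ∑[ j ∈ js ] (w * ∑[ α ∈ xs ] (c j * (e j α * g α)))
    ≡⟨ *-distribˡ-∑ w js _ ⟨
  w * ∑[ j ∈ js ] ∑[ α ∈ xs ] (c j * (e j α * g α))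
    ≡⟨ cong (w *_) (∑-comm js xs _) ⟩
  w * ∑[ α ∈ xs ] ∑[ j ∈ js ] (c j * (e j α * g α))
    ≡⟨ cong (w *_) (∑-cong xs (λ α → trans (∑-cong js (λ j → sym (ℚ.*-assoc (c j) (e j α) (g α))))
                                            (sym (*-distribʳ-∑ (g α) js _)))) ⟩
  w * ∑[ α ∈ xs ] (∑[ j ∈ js ] (c j * e j α) * g α) ∎
  where open ≡-Reasoning

module Moments (n d : ℕ) (c : Idx n d → ℚ) where

  private
    e : Idx n d → Vec Bool (2 ℕ.* n) → ℚ
    e j α = evalMon (𝐯 n d j) α
    w = weight (S n)

  f : Vec Bool (2 ℕ.* n) → ℚ
  f α = ∑[ j ∈ allFin _ ] (c j * e j α)

  eval-cTv : ∀ α → eval (cTv n d c) α ≡ f α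
  eval-cTv α = ∑-map (λ j → (c j , 𝐯 n d j)) (allFin _) (λ (a , x) → a * evalMon x α)

  Mc-expansion : ∀ i → Mc n d c i ≡ w * ∑[ α ∈ S n ] (f α * e i α)
  Mc-expansion i = begin
    ∑[ j ∈ allFin _ ] (M n d i j * c j)
      ≡⟨ ∑-cong (allFin _) (λ j → cong (_* c j) (avg-map (S n) _)) ⟩
    ∑[ j ∈ allFin _ ] ((w * ∑[ α ∈ S n ] (e i α * e j α)) * c j)
      ≡⟨ ∑-cong (allFin _) (λ j → trans (ℚ.*-comm _ (c j))
                                        (cong (λ s → c j * (w * s)) (∑-cong (S n) (λ α → ℚ.*-comm (e i α) (e j α))))) ⟩
    ∑[ j ∈ allFin _ ] (c j * (w * ∑[ α ∈ S n ] (e j α * e i α)))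
      ≡⟨ ∑-pairing (allFin _) (S n) c e w (e i) ⟩
    w * ∑[ α ∈ S n ] (f α * e i α) ∎
    where open ≡-Reasoning

  cᵀMc≡𝔼f² : ∑[ i ∈ allFin _ ] (c i * Mc n d c i) ≡ Expect n (λ α → f α * f α)
  cᵀMc≡𝔼f² = begin
    ∑[ i ∈ allFin _ ] (c i * Mc n d c i)
      ≡⟨ ∑-cong (allFin _) (λ i → cong (c i *_)
           (trans (Mc-expansion i) (cong (w *_) (∑-cong (S n) (λ α → ℚ.*-comm (f α) (e i α)))))) ⟩
    ∑[ i ∈ allFin _ ] (c i * (w * ∑[ α ∈ S n ] (e i α * f α)))
      ≡⟨ ∑-pairing (allFin _) (S n) c e w f ⟩
    w * ∑[ α ∈ S n ] (f α * f α)
      ≡⟨ avg-map (S n) _ ⟨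
    Expect n (λ α → f α * f α) ∎
    where open ≡-Reasoning

  cTv-vanishes : (∀ i → Mc n d c i ≡ 0ℚ) → ∀ {α} → α ∈ S n → eval (cTv n d c) α ≡ 0ℚ
  cTv-vanishes Mc≡0 {α} α∈S = trans (eval-cTv α) (avg-squares-≡0 (S n) f 𝔼f²≡0 α∈S)
    where
    𝔼f²≡0 : Expect n (λ α → f α * f α) ≡ 0ℚ
    𝔼f²≡0 = trans (sym cᵀMc≡𝔼f²) (∑-zero (allFin _) (λ i → trans (cong (c i *_) (Mc≡0 i)) (ℚ.*-zeroʳ (c i))))

lemma6p1 : (n : ℕ) → 1 ≤ n → (d : ℕ) → d ≤ n →
    (c : Idx n d → ℚ) → (∀ i → Mc n d c i ≡ 0ℚ) →
    Derivation n (cTv n d c) d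
lemma6p1 n _ d d≤n c Mc≡0 = derivation (cTv-homogenizable d≤n c)
  where
  open Modulo n d
  open Homogenization n d
  open Moments n d c
  open ≡-Reasoning
  derivation : Homogenizable (coeff (cTv n d c)) → Derivation n (cTv n d c) d
  derivation (a , onA , cTv∼a) = ∼𝟘⇒Derivation (cTv n d c) (∼-trans cTv∼a (≗⇒∼ multilinear-a≗𝟘))
    where
    vanish : SubsetSumsVanish n a
    vanish α |α|≡n = begin
      sumSubsets α a          ≡⟨ eval-multilinear a α ⟨
      eval (multilinear a) α  ≡⟨ eval-resp-∼ (cTv n d c) (multilinear a) cTv∼a |α|≡n ⟨
      eval (cTv n d c) α      ≡⟨ cTv-vanishes Mc≡0 (∈-S |α|≡n) ⟩
      0ℚ                      ∎
    d+n≤2n : d ℕ.+ n ≤ 2 ℕ.* n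
    d+n≤2n = ℕ.≤-trans (ℕ.+-monoˡ-≤ n d≤n) (ℕ.≤-reflexive (cong (n ℕ.+_) (sym (ℕ.+-identityʳ n))))
    a≗0 : ∀ X → a X ≡ 0ℚ
    a≗0 = subsetSums-injective (2 ℕ.* n) d n d≤n d+n≤2n a onA vanish
    multilinear-a≗𝟘 : coeff (multilinear a) ≗ 𝟘
    multilinear-a≗𝟘 m = trans (coeff-multilinear a m) (∑-zero (allBool _) (λ X →
      trans (cong (_* δ (squarefree X) m) (a≗0 X)) (ℚ.*-zeroˡ (δ (squarefree X) m))))
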